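{- Let $G$ be a maximal $3$-$\gamma_{c}$-vertex critical graph of order $n$, with independence number $\alpha$ and clique number $\omega$. Then $\alpha + \omega \leq n-1$, and equality holds if and only if $G \in \mathcal{G}_{1}(l)$ for some $l \geq 2$.
   Context: All graphs are finite, simple and connected. A connected dominating set of $G$ is a set $D \subseteq V(G)$ such that every vertex of $G$ is in $D$ or adjacent to a vertex of $D$, and $G[D]$ is connected; $\gamma_{c}(G)$ is the minimum size of such a set. $G$ is $k$-$\gamma_{c}$-edge critical if $\gamma_{c}(G)=k$ and $\gamma_{c}(G+uv)<k$ for every pair of non-adjacent vertices $u,v$. A $2$-connected graph $G$ is $k$-$\gamma_{c}$-vertex critical if $\gamma_{c}(G)=k$ and $\gamma_{c}(G-v)<k$ for every $v \in V(G)$. $G$ is maximal $k$-$\gamma_{c}$-vertex critical if it is both $k$-$\gamma_{c}$-edge critical and $k$-$\gamma_{c}$-vertex critical. For $l \geq 2$, the class $\mathcal{G}_{1}(l)$ consists of the graphs obtained as follows: take a vertex $v$, a complete graph on $\{q_{1},\dots,q_{l}\}$ and an independent set $\{z_{1},\dots,z_{l}\}$ (all disjoint); join $v$ to every $z_{i}$; join every $z_{i}$ to every $q_{j}$; then delete the edges $z_{i}q_{i}$ for $1 \leq i \leq l$. (For $l=2$ this is $C_{5}$.) -}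

module Defs where

open import Data.Nat using (ℕ; zero; suc; _+_; _≤_; _<_)
open import Data.Fin using (Fin; zero; suc; splitAt; _≟_)
open import Data.Fin.Subset using (Subset; _∈_; _⊆_; ∣_∣; ⊤; ∁; ⁅_⁆)
open import Data.Bool using (Bool; true; false; T; _∨_; _∧_; not)
open import Data.Sum using (_⊎_; inj₁; inj₂)
open import Data.Product using (_×_; ∃; ∃-syntax; Σ-syntax)
open import Relation.Nullary using (¬_; does)
open import Relation.Binary.PropositionalEquality using (_≡_; _≢_)

Graph : ℕ → Set
Graph n = Fin n → Fin n → Bool

Adj : ∀ {n} → Graph n → Fin n → Fin n → Set
Adj G x y = T (G x y)

IsSimple : ∀ {n} → Graph n → Set
IsSimple {n} G = (∀ (x : Fin n) → ¬ Adj G x x) × (∀ (x y : Fin n) → Adj G x y → Adj G y x)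

-- walks all of whose vertices lie in W (i.e. walks in the induced subgraph G[W])
data WalkIn {n} (G : Graph n) (W : Subset n) : Fin n → Fin n → Set where
  here : ∀ {x} → x ∈ W → WalkIn G W x x
  step : ∀ {x y z} → x ∈ W → Adj G x y → WalkIn G W y z → WalkIn G W x z

ConnectedOn : ∀ {n} → Graph n → Subset n → Set
ConnectedOn {n} G W = ∀ (x y : Fin n) → x ∈ W → y ∈ W → WalkIn G W x y

IsCDSOn : ∀ {n} → Graph n → Subset n → Subset n → Set
IsCDSOn {n} G W D =
  D ⊆ W ×
  (∀ (x : Fin n) → x ∈ W → x ∈ D ⊎ ∃[ y ] (y ∈ D × Adj G x y)) ×
  ConnectedOn G D

GammaCOnIs : ∀ {n} → Graph n → Subset n → ℕ → Set
GammaCOnIs G W k =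
  (∃[ D ] (IsCDSOn G W D × ∣ D ∣ ≡ k)) × (∀ D → IsCDSOn G W D → k ≤ ∣ D ∣)

GammaCOnLess : ∀ {n} → Graph n → Subset n → ℕ → Set
GammaCOnLess G W k = ∃[ D ] (IsCDSOn G W D × ∣ D ∣ < k)

addEdge : ∀ {n} → Graph n → Fin n → Fin n → Graph n
addEdge G u v x y =
  G x y ∨ (does (x ≟ u) ∧ does (y ≟ v)) ∨ (does (x ≟ v) ∧ does (y ≟ u))

-- G - v is the induced subgraph on the complement of {v}
minusVertex : ∀ {n} → Fin n → Subset n
minusVertex v = ∁ ⁅ v ⁆

TwoConnected : ∀ {n} → Graph n → Set
TwoConnected {n} G = 3 ≤ n × ConnectedOn G ⊤ × (∀ (v : Fin n) → ConnectedOn G (minusVertex v))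

EdgeCritical : ∀ {n} → Graph n → ℕ → Set
EdgeCritical {n} G k =
  GammaCOnIs G ⊤ k ×
  (∀ (u v : Fin n) → u ≢ v → ¬ Adj G u v → GammaCOnLess (addEdge G u v) ⊤ k)

VertexCritical : ∀ {n} → Graph n → ℕ → Set
VertexCritical {n} G k =
  TwoConnected G × GammaCOnIs G ⊤ k × (∀ (v : Fin n) → GammaCOnLess G (minusVertex v) k)

MaximalVertexCritical : ∀ {n} → Graph n → ℕ → Set
MaximalVertexCritical G k = EdgeCritical G k × VertexCritical G k

IsIndependent : ∀ {n} → Graph n → Subset n → Set
IsIndependent {n} G S = ∀ (x y : Fin n) → x ∈ S → y ∈ S → ¬ Adj G x y

IsClique : ∀ {n} → Graph n → Subset n → Set
IsClique {n} G S = ∀ (x y : Fin n) → x ∈ S → y ∈ S → x ≢ y → Adj G x y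

IndependenceNumberIs : ∀ {n} → Graph n → ℕ → Set
IndependenceNumberIs G a =
  (∃[ S ] (IsIndependent G S × ∣ S ∣ ≡ a)) × (∀ S → IsIndependent G S → ∣ S ∣ ≤ a)

CliqueNumberIs : ∀ {n} → Graph n → ℕ → Set
CliqueNumberIs G w =
  (∃[ S ] (IsClique G S × ∣ S ∣ ≡ w)) × (∀ S → IsClique G S → ∣ S ∣ ≤ w)

-- The class G1(l): vertices v, z_1..z_l, q_1..q_l, encoded on Fin (1 + (l + l)):
-- zero = v, suc i with splitAt l i = inj₁ a is z_a, inj₂ b is q_b.
data G1Vertex (l : ℕ) : Set where
  vV : G1Vertex l
  zV : Fin l → G1Vertex l
  qV : Fin l → G1Vertex l

g1vertex : ∀ {l} → Fin (suc (l + l)) → G1Vertex l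
g1vertex zero = vV
g1vertex {l} (suc i) with splitAt l i
... | inj₁ a = zV a
... | inj₂ b = qV b

g1adj : ∀ {l} → G1Vertex l → G1Vertex l → Bool
g1adj vV     (zV _) = true
g1adj (zV _) vV     = true
g1adj (zV i) (qV j) = not (does (i ≟ j))
g1adj (qV i) (zV j) = not (does (i ≟ j))
g1adj (qV i) (qV j) = not (does (i ≟ j))
g1adj _      _      = false

G1 : (l : ℕ) → Graph (suc (l + l))
G1 l x y = g1adj {l} (g1vertex {l} x) (g1vertex {l} y)

Isomorphic : ∀ {n m} → Graph n → Graph m → Set
Isomorphic {n} {m} G H =
  Σ[ f ∈ (Fin n → Fin m) ] Σ[ g ∈ (Fin m → Fin n) ]
    ((∀ x → g (f x) ≡ x) × (∀ y → f (g y) ≡ y) × (∀ x y → G x y ≡ H (f x) (f y)))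

-- Let S be a maximum independent set and K a maximum clique, so |S ∩ K| ≤ 1.  Vertex-criticality
-- provides, for each vertex v, an edge that dominates G − v and has no end in N[v]; for v ∈ K its
-- ends lie outside K.  If S ∩ K = ∅ this yields a vertex t ∉ S ∪ K; if S ∩ K = {w}, the edges for w
-- and for some other k ∈ K yield t₁ ∉ N[w] and t₂ ∈ N(w) outside S ∪ K.  Either way α + ω + 1 ≤ n.
-- At equality the critical edge of t₁ is {w, k} with k ∈ K, or {w, t₂}: in the first case t₂ has no
-- neighbour in S − w, so w can be traded for t₂ in S; in the second, edge-criticality makes t₁
-- adjacent to all of K − w, so w can be traded for t₁ in K.  Hence V = S ⊔ K ⊔ {t}, and the
-- critical edges of the vertices of S and K pair them off as the non-edges of a perfect matching,
-- with t adjacent exactly to S: this is G₁(|K|).  Conversely G₁(l) has an independent set and a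
-- clique of size l, so its order 2l + 1 is at most α + ω + 1.

module Submission where

open import Defs
open import Data.Bool using (Bool; true; false; T; not)
open import Data.Unit using (tt)
open import Data.Bool.Properties using (T?; T-∨; T-∧)
open import Data.Empty using (⊥; ⊥-elim)
open import Data.Fin using (Fin; zero; suc; _≟_; fromℕ<; splitAt; _↑ˡ_; _↑ʳ_)
open import Data.Fin.Properties
  using (any?; injective⇒≤; suc-injective; splitAt-↑ˡ; splitAt-↑ʳ; splitAt⁻¹-↑ˡ; splitAt⁻¹-↑ʳ)
open import Data.Fin.Subset
  using (Subset; _∈_; _∉_; _⊆_; ∣_∣; ⊤; ⁅_⁆; _∪_; _∩_; inside; outside; Nonempty)
open import Data.Fin.Subset.Properties
  using (_∈?_; ∈⊤; ⊆-antisym; x∈⁅x⁆; x∈⁅y⁆⇒x≡y; ∣⁅x⁆∣≡1; x∈p∪q⁺; x∈p∪q⁻; x∈p∩q⁺; x∈p∩q⁻;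
         p⊆q⇒∣p∣≤∣q∣; p⊂q⇒∣p∣<∣q∣; ∪-identityʳ; nonempty?; Empty-unique; ∣⊥∣≡0;
         x∈∁p⇒x∉p; x∉p⇒x∈∁p; ∣p∣≤n; ∣p∣≡n⇒p≡⊤)
open import Data.Nat using (ℕ; suc; _+_; _≤_; _<_; s≤s)
open import Data.Nat.Properties
  using (≤-antisym; n≤1+n; +-identityʳ; ≤-trans; ≤-reflexive; m≤m+n; +-suc; <⇒≱; +-mono-≤; +-comm)
open import Data.Product using (Σ-syntax; ∃-syntax; _×_; _,_; proj₁; proj₂; uncurry)
open import Data.Sum using (_⊎_; inj₁; inj₂; [_,_]′; swap; map; map₁; map₂; assocʳ)
open import Data.Vec using (_∷_; []; here; there; tabulate)
open import Data.Vec.Properties using ([]=⇒lookup; lookup⇒[]=; lookup∘tabulate)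
open import Function using (_∘_; id)
open import Function.Bundles using (_⇔_; mk⇔; Equivalence)
open import Relation.Nullary using (¬_; Dec; yes; no; does)
open import Relation.Nullary.Decidable using (_×-dec_; _⊎-dec_; ¬?; dec-true; dec-false)
open import Relation.Unary using (Decidable)
open import Relation.Binary.PropositionalEquality

open Equivalence using (to; from)

private
  variable
    m n : ℕ
    p : Subset n
    x y z : Fin n

-- Finite sets

∣p∪q∣+∣p∩q∣≡∣p∣+∣q∣ : ∀ (p q : Subset n) → ∣ p ∪ q ∣ + ∣ p ∩ q ∣ ≡ ∣ p ∣ + ∣ q ∣
∣p∪q∣+∣p∩q∣≡∣p∣+∣q∣ []            []            = refl
∣p∪q∣+∣p∩q∣≡∣p∣+∣q∣ (inside ∷ p)  (inside ∷ q)  = cong suc (begin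
  ∣ p ∪ q ∣ + suc ∣ p ∩ q ∣   ≡⟨ +-suc ∣ p ∪ q ∣ ∣ p ∩ q ∣ ⟩
  suc (∣ p ∪ q ∣ + ∣ p ∩ q ∣) ≡⟨ cong suc (∣p∪q∣+∣p∩q∣≡∣p∣+∣q∣ p q) ⟩
  suc (∣ p ∣ + ∣ q ∣)         ≡⟨ +-suc ∣ p ∣ ∣ q ∣ ⟨
  ∣ p ∣ + suc ∣ q ∣           ∎)
  where open ≡-Reasoning
∣p∪q∣+∣p∩q∣≡∣p∣+∣q∣ (inside ∷ p)  (outside ∷ q) = cong suc (∣p∪q∣+∣p∩q∣≡∣p∣+∣q∣ p q)
∣p∪q∣+∣p∩q∣≡∣p∣+∣q∣ (outside ∷ p) (inside ∷ q)  =
  trans (cong suc (∣p∪q∣+∣p∩q∣≡∣p∣+∣q∣ p q)) (sym (+-suc ∣ p ∣ ∣ q ∣))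
∣p∪q∣+∣p∩q∣≡∣p∣+∣q∣ (outside ∷ p) (outside ∷ q) = ∣p∪q∣+∣p∩q∣≡∣p∣+∣q∣ p q

∣p∪⁅x⁆∣≡1+∣p∣ : ∀ (p : Subset n) → x ∉ p → ∣ p ∪ ⁅ x ⁆ ∣ ≡ suc ∣ p ∣
∣p∪⁅x⁆∣≡1+∣p∣ {x = zero}  (inside ∷ p)  x∉p = ⊥-elim (x∉p here)
∣p∪⁅x⁆∣≡1+∣p∣ {x = zero}  (outside ∷ p) _   = cong (suc ∘ ∣_∣) (∪-identityʳ p)
∣p∪⁅x⁆∣≡1+∣p∣ {x = suc x} (inside ∷ p)  x∉p = cong suc (∣p∪⁅x⁆∣≡1+∣p∣ p (x∉p ∘ there))
∣p∪⁅x⁆∣≡1+∣p∣ {x = suc x} (outside ∷ p) x∉p = ∣p∪⁅x⁆∣≡1+∣p∣ p (x∉p ∘ there)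

x∈⁅y⁆∪⁅z⁆⁻ : x ∈ ⁅ y ⁆ ∪ ⁅ z ⁆ → x ≡ y ⊎ x ≡ z
x∈⁅y⁆∪⁅z⁆⁻ {y = y} {z = z} x∈ =
  [ inj₁ ∘ x∈⁅y⁆⇒x≡y y , inj₂ ∘ x∈⁅y⁆⇒x≡y z ]′ (x∈p∪q⁻ ⁅ y ⁆ ⁅ z ⁆ x∈)

x∈p∪⁅y⁆⁻ : ∀ (p : Subset n) → x ∈ p ∪ ⁅ y ⁆ → x ∈ p ⊎ x ≡ y
x∈p∪⁅y⁆⁻ {y = y} p = map₂ (x∈⁅y⁆⇒x≡y y) ∘ x∈p∪q⁻ p ⁅ y ⁆

⁅x⁆∪⁅y⁆⊆p : x ∈ p → y ∈ p → ⁅ x ⁆ ∪ ⁅ y ⁆ ⊆ p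
⁅x⁆∪⁅y⁆⊆p {p = p} x∈p y∈p u∈ = [ (λ { refl → x∈p }) , (λ { refl → y∈p }) ]′ (x∈⁅y⁆∪⁅z⁆⁻ u∈)

∣⁅x⁆∪⁅y⁆∣≤2 : ∀ (x y : Fin n) → ∣ ⁅ x ⁆ ∪ ⁅ y ⁆ ∣ ≤ 2
∣⁅x⁆∪⁅y⁆∣≤2 x y = ≤-trans (m≤m+n _ _) (≤-reflexive (begin
  ∣ ⁅ x ⁆ ∪ ⁅ y ⁆ ∣ + ∣ ⁅ x ⁆ ∩ ⁅ y ⁆ ∣ ≡⟨ ∣p∪q∣+∣p∩q∣≡∣p∣+∣q∣ ⁅ x ⁆ ⁅ y ⁆ ⟩
  ∣ ⁅ x ⁆ ∣ + ∣ ⁅ y ⁆ ∣                 ≡⟨ cong₂ _+_ (∣⁅x⁆∣≡1 x) (∣⁅x⁆∣≡1 y) ⟩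
  2                                     ∎))
  where open ≡-Reasoning

2≤∣p∣ : x ∈ p → y ∈ p → x ≢ y → 2 ≤ ∣ p ∣
2≤∣p∣ {x = x} x∈p y∈p x≢y = subst (_< _) (∣⁅x⁆∣≡1 x)
  (p⊂q⇒∣p∣<∣q∣ ((λ u∈ → subst (_∈ _) (sym (x∈⁅y⁆⇒x≡y x u∈)) x∈p) , _ , y∈p , x≢y ∘ sym ∘ x∈⁅y⁆⇒x≡y x))

3≤∣p∣ : x ∈ p → y ∈ p → z ∈ p → x ≢ y → x ≢ z → y ≢ z → 3 ≤ ∣ p ∣
3≤∣p∣ x∈p y∈p z∈p x≢y x≢z y≢z = ≤-trans
  (s≤s (2≤∣p∣ (x∈p∪q⁺ (inj₁ (x∈⁅x⁆ _))) (x∈p∪q⁺ (inj₂ (x∈⁅x⁆ _))) x≢y))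
  (p⊂q⇒∣p∣<∣q∣ (⁅x⁆∪⁅y⁆⊆p x∈p y∈p , _ , z∈p , [ x≢z ∘ sym , y≢z ∘ sym ]′ ∘ x∈⁅y⁆∪⁅z⁆⁻))

1≤∣p∣⇒Nonempty : ∀ {n} {p : Subset n} → 1 ≤ ∣ p ∣ → Nonempty p
1≤∣p∣⇒Nonempty {n = n} {p = p} 1≤∣p∣ with nonempty? p
... | yes ne = ne
... | no ¬ne = ⊥-elim (<⇒≱ 1≤∣p∣ (≤-reflexive (trans (cong ∣_∣ (Empty-unique ¬ne)) (∣⊥∣≡0 n))))

2≤∣p∣⇒other : 2 ≤ ∣ p ∣ → x ∈ p → ∃[ y ] (y ∈ p × y ≢ x)
2≤∣p∣⇒other {p = p} {x = x} 2≤∣p∣ x∈p with any? (λ y → (y ∈? p) ×-dec ¬? (y ≟ x))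
... | yes (y , y∈p , y≢x) = y , y∈p , y≢x
... | no ¬other = ⊥-elim (<⇒≱ 2≤∣p∣ (≤-trans (p⊆q⇒∣p∣≤∣q∣ p⊆⁅x⁆) (≤-reflexive (∣⁅x⁆∣≡1 x))))
  where
  p⊆⁅x⁆ : p ⊆ ⁅ x ⁆
  p⊆⁅x⁆ {y} y∈p with y ≟ x
  ... | yes refl = x∈⁅x⁆ x
  ... | no y≢x = ⊥-elim (¬other (y , y∈p , y≢x))

other-vertex : 2 ≤ n → (v : Fin n) → ∃[ z ] z ≢ v
other-vertex (s≤s (s≤s _)) zero    = suc zero , λ ()
other-vertex (s≤s (s≤s _)) (suc _) = zero , λ ()

record Enumeration (p : Subset n) : Set where
  field
    elem           : Fin ∣ p ∣ → Fin n
    elem∈p         : ∀ i → elem i ∈ p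
    elem-injective : ∀ {i j} → elem i ≡ elem j → i ≡ j
    index          : x ∈ p → Fin ∣ p ∣
    elem-index     : (x∈p : x ∈ p) → elem (index x∈p) ≡ x

  index-elem : ∀ i → index (elem∈p i) ≡ i
  index-elem i = elem-injective (elem-index (elem∈p i))

  index-≡⇔ : (x∈p : x ∈ p) (y∈p : y ∈ p) → index x∈p ≡ index y∈p ⇔ x ≡ y
  index-≡⇔ x∈p y∈p = mk⇔
    (λ eq → trans (sym (elem-index x∈p)) (trans (cong elem eq) (elem-index y∈p)))
    (λ { refl → elem-injective (trans (elem-index x∈p) (sym (elem-index y∈p))) })

enumerate : (p : Subset n) → Enumeration p
enumerate [] = record
  { elem = λ () ; elem∈p = λ () ; elem-injective = λ { {()} } ; index = λ () ; elem-index = λ () }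
enumerate (inside ∷ p) = record
  { elem = elem′ ; elem∈p = elem′∈ ; elem-injective = injective ; index = index′ ; elem-index = elem-index′ }
  where
  open Enumeration (enumerate p)
  elem′ : Fin (suc ∣ p ∣) → Fin (suc _)
  elem′ zero    = zero
  elem′ (suc i) = suc (elem i)
  elem′∈ : ∀ i → elem′ i ∈ inside ∷ p
  elem′∈ zero    = here
  elem′∈ (suc i) = there (elem∈p i)
  injective : ∀ {i j} → elem′ i ≡ elem′ j → i ≡ j
  injective {zero}  {zero}  _  = refl
  injective {suc i} {suc j} eq = cong suc (elem-injective (suc-injective eq))
  index′ : ∀ {x} → x ∈ inside ∷ p → Fin (suc ∣ p ∣)
  index′ here        = zero
  index′ (there x∈p) = suc (index x∈p)
  elem-index′ : ∀ {x} (x∈ : x ∈ inside ∷ p) → elem′ (index′ x∈) ≡ x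
  elem-index′ here        = refl
  elem-index′ (there x∈p) = cong suc (elem-index x∈p)
enumerate (outside ∷ p) = record
  { elem = suc ∘ elem ; elem∈p = there ∘ elem∈p ; elem-injective = elem-injective ∘ suc-injective
  ; index = λ { (there x∈p) → index x∈p } ; elem-index = λ { (there x∈p) → cong suc (elem-index x∈p) } }
  where open Enumeration (enumerate p)

injection⇒≤∣p∣ : (f : Fin m → Fin n) → (∀ i → f i ∈ p) → (∀ {i j} → f i ≡ f j → i ≡ j) → m ≤ ∣ p ∣
injection⇒≤∣p∣ {p = p} f f∈p f-injective =
  injective⇒≤ (λ eq → f-injective (to (index-≡⇔ (f∈p _) (f∈p _)) eq))
  where open Enumeration (enumerate p)

toSubset : {P : Fin n → Set} → Decidable P → Subset n
toSubset P? = tabulate (does ∘ P?)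

∈toSubset⇔ : {P : Fin n → Set} (P? : Decidable P) → x ∈ toSubset P? ⇔ P x
∈toSubset⇔ {x = x} P? = mk⇔
  (λ x∈ → does≡true⇒ (P? x) (trans (sym (lookup∘tabulate _ x)) ([]=⇒lookup x∈)))
  (λ Px → lookup⇒[]= x _ (trans (lookup∘tabulate _ x) (dec-true (P? x) Px)))
  where
  does≡true⇒ : ∀ {A : Set} (A? : Dec A) → does A? ≡ true → A
  does≡true⇒ (yes a) _ = a

exchange : Subset n → Fin n → Fin n → Subset n
exchange p w t = toSubset (λ x → ((x ∈? p) ×-dec ¬? (x ≟ w)) ⊎-dec (x ≟ t))

∈exchange⇔ : ∀ {w t} → x ∈ exchange p w t ⇔ ((x ∈ p × x ≢ w) ⊎ x ≡ t)
∈exchange⇔ {p = p} {w = w} {t} = ∈toSubset⇔ (λ x → ((x ∈? p) ×-dec ¬? (x ≟ w)) ⊎-dec (x ≟ t))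

image : (Fin m → Fin n) → Subset n
image f = toSubset (λ x → any? (λ i → f i ≟ x))

∈image⇔ : {f : Fin m → Fin n} → x ∈ image f ⇔ (∃[ i ] f i ≡ x)
∈image⇔ {f = f} = ∈toSubset⇔ (λ x → any? (λ i → f i ≟ x))

image-size : (f : Fin m → Fin n) → (∀ {i j} → f i ≡ f j → i ≡ j) → m ≤ ∣ image f ∣
image-size f = injection⇒≤∣p∣ f (λ i → from ∈image⇔ (i , refl))

T-does⇒ : ∀ {A : Set} (A? : Dec A) → T (does A?) → A
T-does⇒ (yes a) _ = a

≡not-does : ∀ {b : Bool} {A : Set} (A? : Dec A) → (T b ⇔ (¬ A)) → b ≡ not (does A?)
≡not-does {b = true}  (yes a)  T⇔¬A = ⊥-elim (to T⇔¬A _ a)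
≡not-does {b = true}  (no _)   _    = refl
≡not-does {b = false} (yes _)  _    = refl
≡not-does {b = false} (no ¬a)  T⇔¬A = ⊥-elim (from T⇔¬A ¬a)

-- Domination by pairs of vertices

Dominates : Graph n → Fin n → Fin n → Set
Dominates G a z = z ≡ a ⊎ Adj G z a

Dominates₂ : Graph n → Fin n → Fin n → Fin n → Set
Dominates₂ G a b z = Dominates G a z ⊎ Dominates G b z

dominates-all : ∀ {G : Graph n} {a b k} → Dominates₂ G a b k → (∀ z → z ≢ k → Dominates₂ G a b z) →
  ∀ z → Dominates₂ G a b z
dominates-all {k = k} k-dominated dominated z with z ≟ k
... | yes refl = k-dominated
... | no z≢k   = dominated z z≢k

module _ {G : Graph n} {W : Subset n} where

  walk-source∈ : WalkIn G W x y → x ∈ W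
  walk-source∈ (here x∈W)     = x∈W
  walk-source∈ (step x∈W _ _) = x∈W

  first-step : WalkIn G W x y → x ≢ y → ∃[ y′ ] (Adj G x y′ × y′ ∈ W)
  first-step (here _)         x≢x = ⊥-elim (x≢x refl)
  first-step (step _ x~y′ walk) _ = _ , x~y′ , walk-source∈ walk

small-connected⇒edge : ∀ {G : Graph n} {D} → (∀ y → ¬ Adj G y y) → ConnectedOn G D → ∣ D ∣ < 3 →
  x ∈ D → ∃[ y ] (y ∈ D × Dominates G y x × (∀ {z} → z ∈ D → z ≡ x ⊎ z ≡ y))
small-connected⇒edge {x = x} {G = G} {D} loopless connected small x∈D
  with any? (λ y → (y ∈? D) ×-dec ¬? (y ≟ x))
... | no ¬other = x , x∈D , inj₁ refl , inj₁ ∘ only-x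
  where
  only-x : ∀ {z} → z ∈ D → z ≡ x
  only-x {z} z∈D with z ≟ x
  ... | yes z≡x = z≡x
  ... | no z≢x = ⊥-elim (¬other (z , z∈D , z≢x))
... | yes (y , y∈D , y≢x) = y , y∈D , inj₂ x~y , within
  where
  within : ∀ {z} → z ∈ D → z ≡ x ⊎ z ≡ y
  within {z} z∈D with z ≟ x | z ≟ y
  ... | yes z≡x | _       = inj₁ z≡x
  ... | no _    | yes z≡y = inj₂ z≡y
  ... | no z≢x  | no z≢y  =
    ⊥-elim (<⇒≱ small (3≤∣p∣ x∈D y∈D z∈D (y≢x ∘ sym) (z≢x ∘ sym) (z≢y ∘ sym)))
  x~y : Adj G x y
  x~y with first-step (connected x y x∈D y∈D) (y≢x ∘ sym)
  ... | y′ , x~y′ , y′∈D with within y′∈D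
  ...   | inj₁ refl = ⊥-elim (loopless x x~y′)
  ...   | inj₂ refl = x~y′

∈minusVertex⁺ : ∀ {v : Fin n} → x ≢ v → x ∈ minusVertex v
∈minusVertex⁺ {v = v} x≢v = x∉p⇒x∈∁p (x≢v ∘ x∈⁅y⁆⇒x≡y v)

∈minusVertex⁻ : ∀ {v : Fin n} → x ∈ minusVertex v → x ≢ v
∈minusVertex⁻ {v = v} x∈ refl = x∈∁p⇒x∉p x∈ (x∈⁅x⁆ v)

cds-nonempty : ∀ {G : Graph n} {W D} → IsCDSOn G W D → x ∈ W → Nonempty D
cds-nonempty {x = x} (_ , domination , _) x∈W with domination x x∈W
... | inj₁ x∈D           = x , x∈D
... | inj₂ (y , y∈D , _) = y , y∈D

record DominatingPair (G : Graph n) (W D : Subset n) : Set where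
  field
    a b       : Fin n
    a∈D       : a ∈ D
    b∈D       : b ∈ D
    joined    : Dominates G b a
    dominates : ∀ {z} → z ∈ W → Dominates₂ G a b z

small-cds⇒pair : ∀ {G : Graph n} {W D} → (∀ y → ¬ Adj G y y) →
  IsCDSOn G W D → ∣ D ∣ < 3 → x ∈ D → DominatingPair G W D
small-cds⇒pair {x = x} {G = G} {W} {D} loopless (_ , domination , connected) small x∈D
  with small-connected⇒edge loopless connected small x∈D
... | b , b∈D , joined , within = record
  { a = x ; b = b ; a∈D = x∈D ; b∈D = b∈D ; joined = joined ; dominates = dominates }
  where
  dominates : ∀ {z} → z ∈ W → Dominates₂ G x b z
  dominates {z} z∈W with domination z z∈W
  ... | inj₁ z∈D = [ inj₁ ∘ inj₁ , inj₂ ∘ inj₁ ]′ (within z∈D)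
  ... | inj₂ (y , y∈D , z~y) =
    [ (λ { refl → inj₁ (inj₂ z~y) }) , (λ { refl → inj₂ (inj₂ z~y) }) ]′ (within y∈D)

pair⇒cds : ∀ {G : Graph n} {a b} → (∀ x y → Adj G x y → Adj G y x) →
  Dominates G b a → (∀ z → Dominates₂ G a b z) → ∃[ D ] (IsCDSOn G ⊤ D × ∣ D ∣ ≤ 2)
pair⇒cds {G = G} {a} {b} symmetric joined dominated =
  ⁅ a ⁆ ∪ ⁅ b ⁆ , ((λ _ → ∈⊤) , domination , connected) , ∣⁅x⁆∪⁅y⁆∣≤2 a b
  where
  a∈ : a ∈ ⁅ a ⁆ ∪ ⁅ b ⁆
  a∈ = x∈p∪q⁺ (inj₁ (x∈⁅x⁆ a))
  b∈ : b ∈ ⁅ a ⁆ ∪ ⁅ b ⁆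
  b∈ = x∈p∪q⁺ (inj₂ (x∈⁅x⁆ b))
  domination : ∀ z → z ∈ ⊤ → z ∈ ⁅ a ⁆ ∪ ⁅ b ⁆ ⊎ ∃[ y ] (y ∈ ⁅ a ⁆ ∪ ⁅ b ⁆ × Adj G z y)
  domination z _ with dominated z
  ... | inj₁ (inj₁ refl) = inj₁ a∈
  ... | inj₁ (inj₂ z~a)  = inj₂ (a , a∈ , z~a)
  ... | inj₂ (inj₁ refl) = inj₁ b∈
  ... | inj₂ (inj₂ z~b)  = inj₂ (b , b∈ , z~b)
  a-b : Dominates G b a → WalkIn G (⁅ a ⁆ ∪ ⁅ b ⁆) a b
  a-b (inj₁ a≡b) = subst (WalkIn G _ a) a≡b (here a∈)
  a-b (inj₂ a~b) = step a∈ a~b (here b∈)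
  b-a : Dominates G b a → WalkIn G (⁅ a ⁆ ∪ ⁅ b ⁆) b a
  b-a (inj₁ a≡b) = subst (λ x → WalkIn G (⁅ a ⁆ ∪ ⁅ b ⁆) x a) a≡b (here a∈)
  b-a (inj₂ a~b) = step b∈ (symmetric a b a~b) (here a∈)
  connected : ConnectedOn G (⁅ a ⁆ ∪ ⁅ b ⁆)
  connected x y x∈ y∈ with x∈⁅y⁆∪⁅z⁆⁻ x∈ | x∈⁅y⁆∪⁅z⁆⁻ y∈
  ... | inj₁ refl | inj₁ refl = here x∈
  ... | inj₁ refl | inj₂ refl = a-b joined
  ... | inj₂ refl | inj₁ refl = b-a joined
  ... | inj₂ refl | inj₂ refl = here x∈

Endpoints : Fin n → Fin n → Fin n → Fin n → Set
Endpoints u v x y = (x ≡ u × y ≡ v) ⊎ (x ≡ v × y ≡ u)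

Adj-addEdge⁻ : ∀ {G : Graph n} {u v} → Adj (addEdge G u v) x y → Adj G x y ⊎ Endpoints u v x y
Adj-addEdge⁻ {x = x} {y} {u = u} {v} adj with to T-∨ adj
... | inj₁ x~y = inj₁ x~y
... | inj₂ new with to T-∨ new
...   | inj₁ uv = inj₂ (inj₁ (T-does⇒ (x ≟ u) (proj₁ (to T-∧ uv)) , T-does⇒ (y ≟ v) (proj₂ (to T-∧ uv))))
...   | inj₂ vu = inj₂ (inj₂ (T-does⇒ (x ≟ v) (proj₁ (to T-∧ vu)) , T-does⇒ (y ≟ u) (proj₂ (to T-∧ vu))))

-- The graphs G₁(l)

g1index : ∀ {l} → G1Vertex l → Fin (suc (l + l))
g1index vV           = zero
g1index {l} (zV i)   = suc (i ↑ˡ l)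
g1index {l} (qV j)   = suc (l ↑ʳ j)

g1vertex-g1index : ∀ {l} (u : G1Vertex l) → g1vertex (g1index u) ≡ u
g1vertex-g1index vV                                  = refl
g1vertex-g1index {l} (zV i) rewrite splitAt-↑ˡ l i l = refl
g1vertex-g1index {l} (qV j) rewrite splitAt-↑ʳ l l j = refl

g1index-g1vertex : ∀ l (x : Fin (suc (l + l))) → g1index {l} (g1vertex x) ≡ x
g1index-g1vertex l zero = refl
g1index-g1vertex l (suc i) with splitAt l i in eq
... | inj₁ _ = cong suc (splitAt⁻¹-↑ˡ eq)
... | inj₂ _ = cong suc (splitAt⁻¹-↑ʳ eq)

labelling⇒Isomorphic : ∀ {l} {G : Graph n} (f : Fin n → G1Vertex l) (f⁻¹ : G1Vertex l → Fin n) →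
  (∀ x → f⁻¹ (f x) ≡ x) → (∀ u → f (f⁻¹ u) ≡ u) → (∀ x y → G x y ≡ g1adj (f x) (f y)) →
  Isomorphic G (G1 l)
labelling⇒Isomorphic {l = l} {G} f f⁻¹ f⁻¹∘f f∘f⁻¹ adjacency =
  g1index ∘ f , f⁻¹ ∘ g1vertex , left-inverse , right-inverse , preserves
  where
  left-inverse : ∀ x → f⁻¹ (g1vertex (g1index (f x))) ≡ x
  left-inverse x = trans (cong f⁻¹ (g1vertex-g1index (f x))) (f⁻¹∘f x)
  right-inverse : ∀ y → g1index (f (f⁻¹ (g1vertex y))) ≡ y
  right-inverse y = trans (cong g1index (f∘f⁻¹ (g1vertex y))) (g1index-g1vertex l y)
  preserves : ∀ x y → G x y ≡ G1 l (g1index (f x)) (g1index (f y))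
  preserves x y =
    trans (adjacency x y) (sym (cong₂ g1adj (g1vertex-g1index (f x)) (g1vertex-g1index (f y))))

independent-family⇒≤ : ∀ {G : Graph n} {α} (h : Fin m → Fin n) → (∀ {i j} → h i ≡ h j → i ≡ j) →
  (∀ i j → ¬ Adj G (h i) (h j)) → IndependenceNumberIs G α → m ≤ α
independent-family⇒≤ {G = G} h h-injective non-adjacent (_ , maximum) =
  ≤-trans (image-size h h-injective) (maximum (image h) independent)
  where
  independent : IsIndependent G (image h)
  independent x y x∈ y∈ with to (∈image⇔ {f = h}) x∈ | to (∈image⇔ {f = h}) y∈
  ... | i , refl | j , refl = non-adjacent i j

clique-family⇒≤ : ∀ {G : Graph n} {ω} (h : Fin m → Fin n) → (∀ {i j} → h i ≡ h j → i ≡ j) →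
  (∀ i j → i ≢ j → Adj G (h i) (h j)) → CliqueNumberIs G ω → m ≤ ω
clique-family⇒≤ {G = G} h h-injective adjacent (_ , maximum) =
  ≤-trans (image-size h h-injective) (maximum (image h) clique)
  where
  clique : IsClique G (image h)
  clique x y x∈ y∈ x≢y with to (∈image⇔ {f = h}) x∈ | to (∈image⇔ {f = h}) y∈
  ... | i , refl | j , refl = adjacent i j (x≢y ∘ cong h)

G1-order≤ : ∀ {G : Graph n} {α ω l} → IndependenceNumberIs G α → CliqueNumberIs G ω →
  Isomorphic G (G1 l) → n ≤ α + ω + 1
G1-order≤ {n = n} {G} {α} {ω} {l} independence clique (f , g , g∘f , f∘g , preserves) =
  ≤-trans (injective⇒≤ f-injective) (≤-trans (s≤s (+-mono-≤ l≤α l≤ω)) (≤-reflexive (+-comm 1 (α + ω))))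
  where
  open ≡-Reasoning
  f-injective : ∀ {x y} → f x ≡ f y → x ≡ y
  f-injective {x} {y} eq = trans (sym (g∘f x)) (trans (cong g eq) (g∘f y))
  vertex : G1Vertex l → Fin n
  vertex = g ∘ g1index
  vertex-injective : ∀ {u v} → vertex u ≡ vertex v → u ≡ v
  vertex-injective {u} {v} eq = begin
    u                             ≡⟨ g1vertex-g1index u ⟨
    g1vertex {l} (g1index u)          ≡⟨ cong g1vertex (f∘g (g1index u)) ⟨
    g1vertex {l} (f (vertex u))       ≡⟨ cong (g1vertex ∘ f) eq ⟩
    g1vertex {l} (f (vertex v))       ≡⟨ cong g1vertex (f∘g (g1index v)) ⟩
    g1vertex {l} (g1index v)          ≡⟨ g1vertex-g1index v ⟩
    v                             ∎
  adjacency : ∀ u v → G (vertex u) (vertex v) ≡ g1adj u v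
  adjacency u v = begin
    G (vertex u) (vertex v)
      ≡⟨ preserves (vertex u) (vertex v) ⟩
    G1 l (f (vertex u)) (f (vertex v))
      ≡⟨ cong₂ (G1 l) (f∘g (g1index u)) (f∘g (g1index v)) ⟩
    g1adj (g1vertex {l} (g1index u)) (g1vertex {l} (g1index v))
      ≡⟨ cong₂ (g1adj {l}) (g1vertex-g1index u) (g1vertex-g1index v) ⟩
    g1adj u v
      ∎
  l≤α : l ≤ α
  l≤α = independent-family⇒≤ (vertex ∘ zV) (λ eq → zV-injective (vertex-injective eq))
          (λ i j → subst T (adjacency (zV i) (zV j))) independence
    where
    zV-injective : ∀ {i j} → zV {l} i ≡ zV j → i ≡ j
    zV-injective refl = refl
  l≤ω : l ≤ ω
  l≤ω = clique-family⇒≤ (vertex ∘ qV) (λ eq → qV-injective (vertex-injective eq))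
          (λ i j i≢j → subst T (sym (trans (adjacency (qV i) (qV j)) (cong not (dec-false (i ≟ j) i≢j)))) tt)
          clique
    where
    qV-injective : ∀ {i j} → qV {l} i ≡ qV j → i ≡ j
    qV-injective refl = refl

-- Maximal 3-γc-vertex-critical graphs

module MaximalCritical {n} (G : Graph n) (simple : IsSimple G) (critical : MaximalVertexCritical G 3) where

  infix 4 _~_ _≁_

  _~_ : Fin n → Fin n → Set
  x ~ y = Adj G x y

  _≁_ : Fin n → Fin n → Set
  x ≁ y = ¬ x ~ y

  ~-irrefl : ∀ x → x ≁ x
  ~-irrefl = proj₁ simple

  ~-sym : x ~ y → y ~ x
  ~-sym = proj₂ simple _ _

  _~?_ : ∀ x y → Dec (x ~ y)
  x ~? y = T? (G x y)

  γc≥3 : ∀ D → IsCDSOn G ⊤ D → 3 ≤ ∣ D ∣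
  γc≥3 = proj₂ (proj₁ (proj₁ critical))

  no-dominating-pair : ∀ {a b} → Dominates G b a → ¬ (∀ z → Dominates₂ G a b z)
  no-dominating-pair joined dominated with pair⇒cds (λ _ _ → ~-sym) joined dominated
  ... | D , cds , ∣D∣≤2 = <⇒≱ (s≤s ∣D∣≤2) (γc≥3 D cds)

  2≤n : 2 ≤ n
  2≤n = ≤-trans (n≤1+n 2) (proj₁ (proj₁ (proj₂ critical)))

  neighbour : ∀ v → ∃[ u ] v ~ u
  neighbour v with other-vertex 2≤n v
  ... | z , z≢v with first-step (proj₁ (proj₂ (proj₁ (proj₂ critical))) v z ∈⊤ ∈⊤) (z≢v ∘ sym)
  ...   | u , v~u , _ = u , v~u

  edge⇒2≤ω : ∀ {ω} → CliqueNumberIs G ω → x ~ y → 2 ≤ ω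
  edge⇒2≤ω {x = x} {y} (_ , maximum) x~y =
    ≤-trans (2≤∣p∣ x∈ y∈ x≢y) (maximum (⁅ x ⁆ ∪ ⁅ y ⁆) edge-clique)
    where
    x≢y : x ≢ y
    x≢y x≡y = ~-irrefl x (subst (x ~_) (sym x≡y) x~y)
    x∈ : x ∈ ⁅ x ⁆ ∪ ⁅ y ⁆
    x∈ = x∈p∪q⁺ (inj₁ (x∈⁅x⁆ x))
    y∈ : y ∈ ⁅ x ⁆ ∪ ⁅ y ⁆
    y∈ = x∈p∪q⁺ (inj₂ (x∈⁅x⁆ y))
    edge-clique : IsClique G (⁅ x ⁆ ∪ ⁅ y ⁆)
    edge-clique u v u∈ v∈ u≢v with x∈⁅y⁆∪⁅z⁆⁻ u∈ | x∈⁅y⁆∪⁅z⁆⁻ v∈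
    ... | inj₁ refl | inj₁ refl = ⊥-elim (u≢v refl)
    ... | inj₁ refl | inj₂ refl = x~y
    ... | inj₂ refl | inj₁ refl = ~-sym x~y
    ... | inj₂ refl | inj₂ refl = ⊥-elim (u≢v refl)

  no-dominating-vertex : ∀ {a v} → v ≁ a → ¬ (∀ z → z ≢ v → Dominates G a z)
  no-dominating-vertex {a} {v} v≁a dominated with neighbour v
  ... | u , v~u with dominated u (λ { refl → ~-irrefl u v~u })
  ...   | inj₁ refl = v≁a v~u
  ...   | inj₂ u~a  = no-dominating-pair (inj₂ (~-sym u~a))
                        (dominates-all (inj₂ (inj₂ v~u)) (λ z → inj₁ ∘ dominated z))

  G-v-cds-avoids-N[v] : ∀ {v D} → IsCDSOn G (minusVertex v) D → ∣ D ∣ < 3 → x ∈ D → v ≁ x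
  G-v-cds-avoids-N[v] {x = x} {v} {D} (_ , domination , connected) small x∈D v~x =
    <⇒≱ small (γc≥3 D ((λ _ → ∈⊤) , domination-G , connected))
    where
    domination-G : ∀ z → z ∈ ⊤ → z ∈ D ⊎ ∃[ y ] (y ∈ D × z ~ y)
    domination-G z _ with z ≟ v
    ... | yes refl = inj₂ (x , x∈D , v~x)
    ... | no z≢v   = domination z (∈minusVertex⁺ z≢v)

  record CriticalEdge (v : Fin n) : Set where
    field
      a b       : Fin n
      a~b       : a ~ b
      v≁a       : v ≁ a
      v≁b       : v ≁ b
      a≢v       : a ≢ v
      b≢v       : b ≢ v
      dominates : ∀ z → z ≢ v → Dominates₂ G a b z

    flip : CriticalEdge v
    flip = record
      { a = b ; b = a ; a~b = ~-sym a~b ; v≁a = v≁b ; v≁b = v≁a ; a≢v = b≢v ; b≢v = a≢v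
      ; dominates = λ z z≢v → swap (dominates z z≢v) }

  critical-edge-end∉clique : ∀ {K k} → IsClique G K → k ∈ K → (E : CriticalEdge k) → CriticalEdge.a E ∉ K
  critical-edge-end∉clique K-clique k∈K E a∈K = v≁a (K-clique _ _ k∈K a∈K (a≢v ∘ sym))
    where open CriticalEdge E

  abstract
    critical-edge : ∀ v → CriticalEdge v
    critical-edge v with proj₂ (proj₂ (proj₂ critical)) v
    ... | D , cds@(D⊆G-v , _) , small with other-vertex 2≤n v
    ...   | z , z≢v =
      from-pair (small-cds⇒pair ~-irrefl cds small (proj₂ (cds-nonempty cds (∈minusVertex⁺ z≢v))))
      where
      from-pair : DominatingPair G (minusVertex v) D → CriticalEdge v
      from-pair record { a = a ; b = b ; a∈D = a∈D ; b∈D = b∈D ; joined = inj₂ a~b ; dominates = dominates } =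
        record { a = a ; b = b ; a~b = a~b
               ; v≁a = G-v-cds-avoids-N[v] cds small a∈D ; v≁b = G-v-cds-avoids-N[v] cds small b∈D
               ; a≢v = ∈minusVertex⁻ (D⊆G-v a∈D) ; b≢v = ∈minusVertex⁻ (D⊆G-v b∈D)
               ; dominates = λ z → dominates ∘ ∈minusVertex⁺ }
      from-pair record { a∈D = a∈D ; joined = inj₁ refl ; dominates = dominates } =
        ⊥-elim (no-dominating-vertex (G-v-cds-avoids-N[v] cds small a∈D)
                                     (λ z → [ id , id ]′ ∘ dominates ∘ ∈minusVertex⁺))

  Dominates⁺ : Fin n → Fin n → Fin n → Fin n → Set
  Dominates⁺ u v y z = Dominates G y z ⊎ Endpoints u v z y

  Dominates-addEdge⁻ : ∀ {u v} → Dominates (addEdge G u v) y z → Dominates⁺ u v y z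
  Dominates-addEdge⁻ (inj₁ z≡y) = inj₁ (inj₁ z≡y)
  Dominates-addEdge⁻ (inj₂ z~y) = map₁ inj₂ (Adj-addEdge⁻ {G = G} z~y)

  Dominates⁺⇒ : ∀ {u v} → Dominates⁺ u v y z → Dominates G y z ⊎ Dominates₂ G u v z
  Dominates⁺⇒ = map₂ [ inj₁ ∘ inj₁ ∘ proj₁ , inj₂ ∘ inj₁ ∘ proj₁ ]′

  Dominates⁺-away : ∀ {u v} → y ≢ u → y ≢ v → Dominates⁺ u v y z → Dominates G y z
  Dominates⁺-away y≢u y≢v = [ id , [ ⊥-elim ∘ y≢v ∘ proj₂ , ⊥-elim ∘ y≢u ∘ proj₂ ]′ ]′

  record PairAfterAdding (u v : Fin n) : Set where
    field
      a b       : Fin n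
      joined    : Dominates⁺ u v b a
      dominates : ∀ z → Dominates⁺ u v a z ⊎ Dominates⁺ u v b z

    flip-pair : PairAfterAdding u v
    flip-pair = record { a = b ; b = a ; joined = reversed joined ; dominates = swap ∘ dominates }
      where
      reversed : Dominates⁺ u v b a → Dominates⁺ u v a b
      reversed (inj₁ (inj₁ a≡b))         = inj₁ (inj₁ (sym a≡b))
      reversed (inj₁ (inj₂ a~b))         = inj₁ (inj₂ (~-sym a~b))
      reversed (inj₂ (inj₁ (a≡u , b≡v))) = inj₂ (inj₂ (b≡v , a≡u))
      reversed (inj₂ (inj₂ (a≡v , b≡u))) = inj₂ (inj₁ (b≡u , a≡v))

    flip-ends : PairAfterAdding v u
    flip-ends = record
      { a = a ; b = b ; joined = map₂ swap joined ; dominates = map (map₂ swap) (map₂ swap) ∘ dominates }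

  -- The shapes, seen in G, of a connected dominating set of size at most 2 of G + uv.
  data EdgeAddition (u v : Fin n) : Set where
    both-ends : (∀ z → Dominates₂ G u v z) → EdgeAddition u v
    left-end  : ∀ {x} → u ~ x → (∀ z → z ≢ v → Dominates₂ G u x z) → EdgeAddition u v
    right-end : ∀ {x} → v ~ x → (∀ z → z ≢ u → Dominates₂ G v x z) → EdgeAddition u v

  EdgeAddition-sym : ∀ {u v} → EdgeAddition u v → EdgeAddition v u
  EdgeAddition-sym (both-ends dominated)   = both-ends (swap ∘ dominated)
  EdgeAddition-sym (left-end u~x dominated)  = right-end u~x dominated
  EdgeAddition-sym (right-end v~x dominated) = left-end v~x dominated

  pair-at-end : ∀ {u v} → u ≢ v → (P : PairAfterAdding u v) → PairAfterAdding.a P ≡ u → EdgeAddition u v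
  pair-at-end {u} {v} u≢v record { b = b ; joined = joined ; dominates = dominates } refl
    with b ≟ v | b ≟ u
  ... | yes refl | _        = both-ends λ z →
    [ [ inj₁ , id ]′ ∘ Dominates⁺⇒ , [ inj₂ , id ]′ ∘ Dominates⁺⇒ ]′ (dominates z)
  ... | no _     | yes refl = both-ends λ z →
    [ [ inj₁ , id ]′ ∘ Dominates⁺⇒ , [ inj₁ , id ]′ ∘ Dominates⁺⇒ ]′ (dominates z)
  ... | no b≢v   | no b≢u   = left-end (u~b joined) λ z z≢v →
    map [ id , [ ⊥-elim ∘ u≢v ∘ proj₂ , ⊥-elim ∘ z≢v ∘ proj₁ ]′ ]′ (Dominates⁺-away b≢u b≢v) (dominates z)
    where
    u~b : Dominates⁺ u v b u → u ~ b
    u~b (inj₁ (inj₁ u≡b))       = ⊥-elim (b≢u (sym u≡b))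
    u~b (inj₁ (inj₂ u~b))       = u~b
    u~b (inj₂ (inj₁ (_ , b≡v))) = ⊥-elim (b≢v b≡v)
    u~b (inj₂ (inj₂ (u≡v , _))) = ⊥-elim (u≢v u≡v)

  abstract
    edge-critical : ∀ {u v} → u ≢ v → u ≁ v → EdgeAddition u v
    edge-critical {u} {v} u≢v u≁v with proj₂ (proj₁ critical) u v u≢v u≁v
    ... | D , cds , small =
      classify (after-adding (small-cds⇒pair H-irrefl cds small (proj₂ (cds-nonempty cds (∈⊤ {x = u})))))
      where
      H : Graph n
      H = addEdge G u v
      H-irrefl : ∀ x → ¬ Adj H x x
      H-irrefl x x~x with Adj-addEdge⁻ {G = G} x~x
      ... | inj₁ x~x′               = ~-irrefl x x~x′
      ... | inj₂ (inj₁ (x≡u , x≡v)) = u≢v (trans (sym x≡u) x≡v)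
      ... | inj₂ (inj₂ (x≡v , x≡u)) = u≢v (trans (sym x≡u) x≡v)
      after-adding : DominatingPair H ⊤ D → PairAfterAdding u v
      after-adding pair = record
        { a = a ; b = b ; joined = Dominates-addEdge⁻ joined
        ; dominates = λ z → map Dominates-addEdge⁻ Dominates-addEdge⁻ (dominates {z} ∈⊤) }
        where open DominatingPair pair
      classify : PairAfterAdding u v → EdgeAddition u v
      classify P@record { a = a ; b = b ; joined = joined ; dominates = dominates }
        with a ≟ u | a ≟ v | b ≟ u | b ≟ v
      ... | yes a≡u | _       | _       | _       = pair-at-end u≢v P a≡u
      ... | no _    | yes a≡v | _       | _       =
        EdgeAddition-sym (pair-at-end (u≢v ∘ sym) (PairAfterAdding.flip-ends P) a≡v)
      ... | no _    | no _    | yes b≡u | _       = pair-at-end u≢v (PairAfterAdding.flip-pair P) b≡u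
      ... | no _    | no _    | no _    | yes b≡v =
        EdgeAddition-sym
          (pair-at-end (u≢v ∘ sym) (PairAfterAdding.flip-ends (PairAfterAdding.flip-pair P)) b≡v)
      ... | no a≢u  | no a≢v  | no b≢u  | no b≢v  = ⊥-elim (no-dominating-pair
        (Dominates⁺-away b≢u b≢v joined)
        (λ z → map (Dominates⁺-away a≢u a≢v) (Dominates⁺-away b≢u b≢v) (dominates z)))

  -- Graphs partitioned into an independent set, a clique and one vertex

  record G1Decomposition : Set where
    field
      S K           : Subset n
      apex          : Fin n
      S-independent : IsIndependent G S
      K-clique      : IsClique G K
      partition     : ∀ x → x ∈ S ⊎ x ∈ K ⊎ x ≡ apex
      S∩K-empty     : ∀ {x} → x ∈ S → x ∉ K
      apex∉S        : apex ∉ S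
      apex∉K        : apex ∉ K
      2≤∣K∣         : 2 ≤ ∣ K ∣

  module G1Structure (decomposition : G1Decomposition) where
    open G1Decomposition decomposition

    record SMate (k : Fin n) : Set where
      field
        s         : Fin n
        s∈S       : s ∈ S
        k≁s       : k ≁ s
        k≁apex    : k ≁ apex
        apex~s    : apex ~ s
        dominates : ∀ z → z ≢ k → Dominates₂ G apex s z

    SMate-from-edge : ∀ {k} (E : CriticalEdge k) → CriticalEdge.a E ≡ apex → CriticalEdge.b E ∈ S → SMate k
    SMate-from-edge {k} E refl b∈S = record
      { s = b ; s∈S = b∈S ; k≁s = v≁b ; k≁apex = v≁a ; apex~s = a~b ; dominates = dominates }
      where open CriticalEdge E

    abstract
      s-mate : ∀ {k} → k ∈ K → SMate k
      s-mate {k} k∈K = from-edge (critical-edge k)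
        where
        from-edge : CriticalEdge k → SMate k
        from-edge E@record { a = a ; b = b ; a~b = a~b } with partition a | partition b
        ... | inj₂ (inj₁ a∈K)    | _                  = ⊥-elim (critical-edge-end∉clique K-clique k∈K E a∈K)
        ... | _                  | inj₂ (inj₁ b∈K)    =
          ⊥-elim (critical-edge-end∉clique K-clique k∈K (CriticalEdge.flip E) b∈K)
        ... | inj₁ a∈S           | inj₁ b∈S           = ⊥-elim (S-independent a b a∈S b∈S a~b)
        ... | inj₂ (inj₂ refl)   | inj₂ (inj₂ refl)   = ⊥-elim (~-irrefl a a~b)
        ... | inj₁ a∈S           | inj₂ (inj₂ b≡apex) = SMate-from-edge (CriticalEdge.flip E) b≡apex a∈S
        ... | inj₂ (inj₂ a≡apex) | inj₁ b∈S           = SMate-from-edge E a≡apex b∈S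

    apex~S : ∀ {s} → s ∈ S → apex ~ s
    apex~S s∈S with 1≤∣p∣⇒Nonempty (≤-trans (n≤1+n 1) 2≤∣K∣)
    ... | k , k∈K = via k∈K (s-mate k∈K) s∈S
      where
      via : ∀ {k s} → k ∈ K → SMate k → s ∈ S → apex ~ s
      via {s = s} k∈K M s∈S with s ≟ SMate.s M | SMate.dominates M s (λ { refl → S∩K-empty s∈S k∈K })
      ... | yes refl | _                  = SMate.apex~s M
      ... | no _     | inj₁ (inj₁ refl)   = ⊥-elim (apex∉S s∈S)
      ... | no _     | inj₁ (inj₂ s~apex) = ~-sym s~apex
      ... | no s≢s′  | inj₂ (inj₁ s≡s′)   = ⊥-elim (s≢s′ s≡s′)
      ... | no _     | inj₂ (inj₂ s~s′)   = ⊥-elim (S-independent _ _ s∈S (SMate.s∈S M) s~s′)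

    K~s-mate : ∀ {k k′} (k∈K : k ∈ K) → k′ ∈ K → k′ ≢ k → k′ ~ SMate.s (s-mate k∈K)
    K~s-mate {k′ = k′} k∈K k′∈K k′≢k with SMate.dominates (s-mate k∈K) k′ k′≢k
    ... | inj₁ (inj₁ refl)    = ⊥-elim (apex∉K k′∈K)
    ... | inj₁ (inj₂ k′~apex) = ⊥-elim (SMate.k≁apex (s-mate k′∈K) k′~apex)
    ... | inj₂ (inj₁ refl)    = ⊥-elim (S∩K-empty (SMate.s∈S (s-mate k∈K)) k′∈K)
    ... | inj₂ (inj₂ k′~s)    = k′~s

    record KMate (s : Fin n) : Set where
      field
        k   : Fin n
        k∈K : k ∈ K
        s≁k : s ≁ k
        S~k : ∀ {s′} → s′ ∈ S → s′ ≢ s → s′ ~ k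

    KMate-from-edge : ∀ {s} (E : CriticalEdge s) → CriticalEdge.a E ∈ S → CriticalEdge.b E ∈ K → KMate s
    KMate-from-edge {s} E a∈S b∈K = record { k = b ; k∈K = b∈K ; s≁k = v≁b ; S~k = S~b }
      where
      open CriticalEdge E
      S~b : ∀ {s′} → s′ ∈ S → s′ ≢ s → s′ ~ b
      S~b {s′} s′∈S s′≢s with dominates s′ s′≢s
      ... | inj₁ (inj₁ refl) = a~b
      ... | inj₁ (inj₂ s′~a) = ⊥-elim (S-independent _ _ s′∈S a∈S s′~a)
      ... | inj₂ (inj₁ refl) = ⊥-elim (S∩K-empty s′∈S b∈K)
      ... | inj₂ (inj₂ s′~b) = s′~b

    abstract
      k-mate : ∀ {s} → s ∈ S → KMate s
      k-mate {s} s∈S = from-edge (critical-edge s)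
        where
        apex-not-end : ∀ {c} → s ≁ c → c ≢ apex
        apex-not-end s≁c refl = s≁c (~-sym (apex~S s∈S))
        apex-undominated : ∀ {c} → c ∈ K → ¬ Dominates G c apex
        apex-undominated c∈K (inj₁ refl)     = apex∉K c∈K
        apex-undominated c∈K (inj₂ apex~c)   = SMate.k≁apex (s-mate c∈K) (~-sym apex~c)
        from-edge : CriticalEdge s → KMate s
        from-edge E@record { a = a ; b = b ; a~b = a~b ; v≁a = v≁a ; v≁b = v≁b ; dominates = dominates }
          with partition a | partition b
        ... | inj₂ (inj₂ a≡apex) | _ = ⊥-elim (apex-not-end v≁a a≡apex)
        ... | _ | inj₂ (inj₂ b≡apex) = ⊥-elim (apex-not-end v≁b b≡apex)
        ... | inj₁ a∈S       | inj₁ b∈S       = ⊥-elim (S-independent a b a∈S b∈S a~b)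
        ... | inj₂ (inj₁ a∈K) | inj₂ (inj₁ b∈K) =
          ⊥-elim ([ apex-undominated a∈K , apex-undominated b∈K ]′ (dominates apex λ { refl → apex∉S s∈S }))
        ... | inj₁ a∈S       | inj₂ (inj₁ b∈K) = KMate-from-edge E a∈S b∈K
        ... | inj₂ (inj₁ a∈K) | inj₁ b∈S       = KMate-from-edge (CriticalEdge.flip E) b∈S a∈K

    k-mate-inverse : ∀ {k s} (k∈K : k ∈ K) (s∈S : s ∈ S) → s ≡ SMate.s (s-mate k∈K) → KMate.k (k-mate s∈S) ≡ k
    k-mate-inverse {k} k∈K s∈S refl with KMate.k (k-mate s∈S) ≟ k
    ... | yes k′≡k = k′≡k
    ... | no k′≢k  = ⊥-elim (KMate.s≁k (k-mate s∈S) (~-sym (K~s-mate k∈K (KMate.k∈K (k-mate s∈S)) k′≢k)))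

    s-mate-inverse : ∀ {s k} (s∈S : s ∈ S) (k∈K : k ∈ K) → k ≡ KMate.k (k-mate s∈S) → SMate.s (s-mate k∈K) ≡ s
    s-mate-inverse {s} s∈S k∈K refl with SMate.s (s-mate k∈K) ≟ s
    ... | yes s′≡s = s′≡s
    ... | no s′≢s  =
      ⊥-elim (SMate.k≁s (s-mate k∈K) (~-sym (KMate.S~k (k-mate s∈S) (SMate.s∈S (s-mate k∈K)) s′≢s)))

    S-K-adjacency : ∀ {s k} (s∈S : s ∈ S) → k ∈ K → s ~ k ⇔ (KMate.k (k-mate s∈S) ≢ k)
    S-K-adjacency {s} {k} s∈S k∈K = mk⇔
      (λ { s~k refl → KMate.s≁k (k-mate s∈S) s~k })
      (λ k′≢k → subst (s ~_) (k-mate-inverse k∈K s′∈S refl) (KMate.S~k (k-mate s′∈S) s∈S (s≢s′ k′≢k)))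
      where
      s′∈S : SMate.s (s-mate k∈K) ∈ S
      s′∈S = SMate.s∈S (s-mate k∈K)
      s≢s′ : KMate.k (k-mate s∈S) ≢ k → s ≢ SMate.s (s-mate k∈K)
      s≢s′ k′≢k s≡s′ = k′≢k (k-mate-inverse k∈K s∈S s≡s′)

    open Enumeration (enumerate K)

    label : Fin n → G1Vertex ∣ K ∣
    label x with partition x
    ... | inj₁ x∈S        = zV (index (KMate.k∈K (k-mate x∈S)))
    ... | inj₂ (inj₁ x∈K) = qV (index x∈K)
    ... | inj₂ (inj₂ _)   = vV

    unlabel : G1Vertex ∣ K ∣ → Fin n
    unlabel vV     = apex
    unlabel (zV i) = SMate.s (s-mate (elem∈p i))
    unlabel (qV i) = elem i

    unlabel∘label : ∀ x → unlabel (label x) ≡ x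
    unlabel∘label x with partition x
    ... | inj₁ x∈S         = s-mate-inverse x∈S (elem∈p _) (elem-index (KMate.k∈K (k-mate x∈S)))
    ... | inj₂ (inj₁ x∈K)  = elem-index x∈K
    ... | inj₂ (inj₂ refl) = refl

    index≡ : ∀ {i} (x∈K : x ∈ K) → x ≡ elem i → index x∈K ≡ i
    index≡ {i = i} x∈K x≡elem = trans (from (index-≡⇔ x∈K (elem∈p i)) x≡elem) (index-elem i)

    label∘unlabel : ∀ u → label (unlabel u) ≡ u
    label∘unlabel vV with partition apex
    ... | inj₁ apex∈S        = ⊥-elim (apex∉S apex∈S)
    ... | inj₂ (inj₁ apex∈K) = ⊥-elim (apex∉K apex∈K)
    ... | inj₂ (inj₂ _)      = refl
    label∘unlabel (zV i) with partition (SMate.s (s-mate (elem∈p i)))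
    ... | inj₁ s∈S        = cong zV (index≡ _ (k-mate-inverse (elem∈p i) s∈S refl))
    ... | inj₂ (inj₁ s∈K) = ⊥-elim (S∩K-empty (SMate.s∈S (s-mate (elem∈p i))) s∈K)
    ... | inj₂ (inj₂ s≡apex) = ⊥-elim (apex∉S (subst (_∈ S) s≡apex (SMate.s∈S (s-mate (elem∈p i)))))
    label∘unlabel (qV i) with partition (elem i)
    ... | inj₁ x∈S        = ⊥-elim (S∩K-empty x∈S (elem∈p i))
    ... | inj₂ (inj₁ x∈K) = cong qV (index≡ x∈K refl)
    ... | inj₂ (inj₂ x≡apex) = ⊥-elim (apex∉K (subst (_∈ K) x≡apex (elem∈p i)))

    adjacency⇔index≢ : ∀ {A : Set} {a b} (a∈K : a ∈ K) (b∈K : b ∈ K) →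
      A ⇔ (a ≢ b) → A ⇔ (index a∈K ≢ index b∈K)
    adjacency⇔index≢ a∈K b∈K A⇔a≢b = mk⇔
      (λ α eq → to A⇔a≢b α (to (index-≡⇔ a∈K b∈K) eq))
      (λ ne → from A⇔a≢b (ne ∘ from (index-≡⇔ a∈K b∈K)))

    label-adjacency : ∀ x y → G x y ≡ g1adj (label x) (label y)
    label-adjacency x y with partition x | partition y
    ... | inj₁ x∈S        | inj₁ y∈S         = dec-false (x ~? y) (S-independent x y x∈S y∈S)
    ... | inj₁ x∈S        | inj₂ (inj₁ y∈K)  =
      ≡not-does (index _ ≟ index y∈K) (adjacency⇔index≢ (KMate.k∈K (k-mate x∈S)) y∈K (S-K-adjacency x∈S y∈K))
    ... | inj₁ x∈S        | inj₂ (inj₂ refl) = dec-true (x ~? y) (~-sym (apex~S x∈S))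
    ... | inj₂ (inj₁ x∈K) | inj₁ y∈S         =
      ≡not-does (index x∈K ≟ index _) (adjacency⇔index≢ x∈K (KMate.k∈K (k-mate y∈S))
        (mk⇔ (λ x~y x≡k′ → to (S-K-adjacency y∈S x∈K) (~-sym x~y) (sym x≡k′))
             (λ x≢k′ → ~-sym (from (S-K-adjacency y∈S x∈K) (x≢k′ ∘ sym)))))
    ... | inj₂ (inj₁ x∈K) | inj₂ (inj₁ y∈K)  =
      ≡not-does (index x∈K ≟ index y∈K)
        (adjacency⇔index≢ x∈K y∈K (mk⇔ (λ { x~y refl → ~-irrefl x x~y }) (K-clique x y x∈K y∈K)))
    ... | inj₂ (inj₁ x∈K) | inj₂ (inj₂ refl) = dec-false (x ~? y) (SMate.k≁apex (s-mate x∈K))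
    ... | inj₂ (inj₂ refl) | inj₁ y∈S        = dec-true (x ~? y) (apex~S y∈S)
    ... | inj₂ (inj₂ refl) | inj₂ (inj₁ y∈K) = dec-false (x ~? y) (SMate.k≁apex (s-mate y∈K) ∘ ~-sym)
    ... | inj₂ (inj₂ refl) | inj₂ (inj₂ refl) = dec-false (x ~? y) (~-irrefl x)

  decomposition⇒G1 : G1Decomposition → ∃[ l ] (2 ≤ l × Isomorphic G (G1 l))
  decomposition⇒G1 decomposition = ∣ K ∣ , 2≤∣K∣ ,
    labelling⇒Isomorphic label unlabel unlabel∘label label∘unlabel label-adjacency
    where
    open G1Decomposition decomposition
    open G1Structure decomposition

  -- The bound α + ω + 1 ≤ n

  record ExtremalSet (α ω : ℕ) : Set where
    field
      X                      : Subset n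
      ∣X∣≡α+ω+1              : ∣ X ∣ ≡ α + ω + 1
      covering⇒decomposition : (∀ x → x ∈ X) → G1Decomposition

  module Extremal {α ω} (independence : IndependenceNumberIs G α) (clique : CliqueNumberIs G ω) where

    S : Subset n
    S = proj₁ (proj₁ independence)
    S-independent : IsIndependent G S
    S-independent = proj₁ (proj₂ (proj₁ independence))
    K : Subset n
    K = proj₁ (proj₁ clique)
    K-clique : IsClique G K
    K-clique = proj₁ (proj₂ (proj₁ clique))

    ∣S∪K∣+∣S∩K∣≡α+ω : ∣ S ∪ K ∣ + ∣ S ∩ K ∣ ≡ α + ω
    ∣S∪K∣+∣S∩K∣≡α+ω =
      trans (∣p∪q∣+∣p∩q∣≡∣p∣+∣q∣ S K)
            (cong₂ _+_ (proj₂ (proj₂ (proj₁ independence))) (proj₂ (proj₂ (proj₁ clique))))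

    2≤ω : 2 ≤ ω
    2≤ω = edge⇒2≤ω clique (proj₂ (neighbour (fromℕ< 2≤n)))

    2≤∣K∣ : 2 ≤ ∣ K ∣
    2≤∣K∣ = subst (2 ≤_) (sym (proj₂ (proj₂ (proj₁ clique)))) 2≤ω

    S∩K-unique : x ∈ S → x ∈ K → y ∈ S → y ∈ K → x ≡ y
    S∩K-unique {x} {y} x∈S x∈K y∈S y∈K with x ≟ y
    ... | yes x≡y = x≡y
    ... | no x≢y  = ⊥-elim (S-independent x y x∈S y∈S (K-clique x y x∈K y∈K x≢y))

    critical-edge-end∉K : ∀ {k} → k ∈ K → (E : CriticalEdge k) → CriticalEdge.a E ∉ K
    critical-edge-end∉K = critical-edge-end∉clique K-clique

    module Disjoint (S∩K-empty : ∀ {x} → x ∈ S → x ∉ K) where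

      outsider : ∃[ t ] (t ∉ S × t ∉ K)
      outsider with 1≤∣p∣⇒Nonempty (≤-trans (n≤1+n 1) 2≤∣K∣)
      ... | k , k∈K with critical-edge k
      ...   | E with CriticalEdge.a E ∈? S
      ...     | yes a∈S = CriticalEdge.b E , (λ b∈S → S-independent _ _ a∈S b∈S (CriticalEdge.a~b E))
                        , critical-edge-end∉K k∈K (CriticalEdge.flip E)
      ...     | no a∉S  = CriticalEdge.a E , a∉S , critical-edge-end∉K k∈K E

      t : Fin n
      t = proj₁ outsider
      t∉S∪K : t ∉ S ∪ K
      t∉S∪K = [ proj₁ (proj₂ outsider) , proj₂ (proj₂ outsider) ]′ ∘ x∈p∪q⁻ S K

      extremal : ExtremalSet α ω
      extremal = record
        { X = (S ∪ K) ∪ ⁅ t ⁆ ; ∣X∣≡α+ω+1 = size ; covering⇒decomposition = decomposition }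
        where
        open ≡-Reasoning
        ∣S∩K∣≡0 : ∣ S ∩ K ∣ ≡ 0
        ∣S∩K∣≡0 = trans (cong ∣_∣ (Empty-unique λ (_ , x∈) → uncurry S∩K-empty (x∈p∩q⁻ S K x∈))) (∣⊥∣≡0 n)
        size : ∣ (S ∪ K) ∪ ⁅ t ⁆ ∣ ≡ α + ω + 1
        size = begin
          ∣ (S ∪ K) ∪ ⁅ t ⁆ ∣          ≡⟨ ∣p∪⁅x⁆∣≡1+∣p∣ (S ∪ K) t∉S∪K ⟩
          suc ∣ S ∪ K ∣                ≡⟨ cong suc (+-identityʳ _) ⟨
          suc (∣ S ∪ K ∣ + 0)          ≡⟨ cong (λ i → suc (∣ S ∪ K ∣ + i)) ∣S∩K∣≡0 ⟨
          suc (∣ S ∪ K ∣ + ∣ S ∩ K ∣)  ≡⟨ cong suc ∣S∪K∣+∣S∩K∣≡α+ω ⟩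
          suc (α + ω)                  ≡⟨ +-comm 1 (α + ω) ⟩
          α + ω + 1                    ∎
        decomposition : (∀ x → x ∈ (S ∪ K) ∪ ⁅ t ⁆) → G1Decomposition
        decomposition covered = record
          { S = S ; K = K ; apex = t ; S-independent = S-independent ; K-clique = K-clique
          ; partition = λ x → assocʳ (map₁ (x∈p∪q⁻ S K) (x∈p∪⁅y⁆⁻ (S ∪ K) (covered x)))
          ; S∩K-empty = S∩K-empty ; apex∉S = proj₁ (proj₂ outsider) ; apex∉K = proj₂ (proj₂ outsider)
          ; 2≤∣K∣ = 2≤∣K∣ }

    module Intersecting {w} (w∈S : w ∈ S) (w∈K : w ∈ K) where

      S∩K≡w : x ∈ S → x ∈ K → x ≡ w
      S∩K≡w x∈S x∈K = S∩K-unique x∈S x∈K w∈S w∈K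

      abstract
        w-edge : Σ[ E ∈ CriticalEdge w ] CriticalEdge.a E ∉ S
        w-edge with critical-edge w
        ... | E with CriticalEdge.a E ∈? S
        ...   | yes a∈S = CriticalEdge.flip E , λ b∈S → S-independent _ _ a∈S b∈S (CriticalEdge.a~b E)
        ...   | no a∉S  = E , a∉S

      E₁ : CriticalEdge w
      E₁ = proj₁ w-edge
      t₁ : Fin n
      t₁ = CriticalEdge.a E₁
      t₁∉S : t₁ ∉ S
      t₁∉S = proj₂ w-edge
      t₁∉K : t₁ ∉ K
      t₁∉K = critical-edge-end∉K w∈K E₁
      w≁t₁ : w ≁ t₁
      w≁t₁ = CriticalEdge.v≁a E₁

      abstract
        edge-at-w : ∀ {k} → k ∈ K → k ≢ w → Σ[ E ∈ CriticalEdge k ] w ~ CriticalEdge.a E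
        edge-at-w {k} k∈K k≢w with critical-edge k
        ... | E with CriticalEdge.dominates E w (k≢w ∘ sym)
        ...   | inj₁ (inj₁ w≡a) = ⊥-elim (critical-edge-end∉K k∈K E (subst (_∈ K) w≡a w∈K))
        ...   | inj₁ (inj₂ w~a) = E , w~a
        ...   | inj₂ (inj₁ w≡b) =
          ⊥-elim (critical-edge-end∉K k∈K (CriticalEdge.flip E) (subst (_∈ K) w≡b w∈K))
        ...   | inj₂ (inj₂ w~b) = CriticalEdge.flip E , w~b

      abstract
        k₀ : Fin n
        k₀ = proj₁ (2≤∣p∣⇒other 2≤∣K∣ w∈K)
        k₀∈K : k₀ ∈ K
        k₀∈K = proj₁ (proj₂ (2≤∣p∣⇒other 2≤∣K∣ w∈K))
        k₀≢w : k₀ ≢ w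
        k₀≢w = proj₂ (proj₂ (2≤∣p∣⇒other 2≤∣K∣ w∈K))

        t₂ : Fin n
        t₂ = CriticalEdge.a (proj₁ (edge-at-w k₀∈K k₀≢w))
        w~t₂ : w ~ t₂
        w~t₂ = proj₂ (edge-at-w k₀∈K k₀≢w)
        t₂∉K : t₂ ∉ K
        t₂∉K = critical-edge-end∉K k₀∈K (proj₁ (edge-at-w k₀∈K k₀≢w))
        t₂∉S : t₂ ∉ S
        t₂∉S t₂∈S = S-independent w t₂ w∈S t₂∈S w~t₂
        t₁≢t₂ : t₁ ≢ t₂
        t₁≢t₂ t₁≡t₂ = w≁t₁ (subst (w ~_) (sym t₁≡t₂) w~t₂)

      X : Subset n
      X = ((S ∪ K) ∪ ⁅ t₁ ⁆) ∪ ⁅ t₂ ⁆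

      ∣X∣≡α+ω+1 : ∣ X ∣ ≡ α + ω + 1
      ∣X∣≡α+ω+1 = begin
        ∣ X ∣                         ≡⟨ ∣p∪⁅x⁆∣≡1+∣p∣ ((S ∪ K) ∪ ⁅ t₁ ⁆) t₂∉ ⟩
        suc ∣ (S ∪ K) ∪ ⁅ t₁ ⁆ ∣      ≡⟨ cong suc (∣p∪⁅x⁆∣≡1+∣p∣ (S ∪ K) t₁∉) ⟩
        suc (suc ∣ S ∪ K ∣)           ≡⟨ cong suc (+-comm 1 ∣ S ∪ K ∣) ⟩
        suc (∣ S ∪ K ∣ + 1)           ≡⟨ cong (λ i → suc (∣ S ∪ K ∣ + i)) ∣S∩K∣≡1 ⟨
        suc (∣ S ∪ K ∣ + ∣ S ∩ K ∣)   ≡⟨ cong suc ∣S∪K∣+∣S∩K∣≡α+ω ⟩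
        suc (α + ω)                   ≡⟨ +-comm 1 (α + ω) ⟩
        α + ω + 1                     ∎
        where
        open ≡-Reasoning
        t₁∉ : t₁ ∉ S ∪ K
        t₁∉ = [ t₁∉S , t₁∉K ]′ ∘ x∈p∪q⁻ S K
        t₂∉ : t₂ ∉ (S ∪ K) ∪ ⁅ t₁ ⁆
        t₂∉ = [ [ t₂∉S , t₂∉K ]′ ∘ x∈p∪q⁻ S K , t₁≢t₂ ∘ sym ]′ ∘ x∈p∪⁅y⁆⁻ (S ∪ K)
        ∣S∩K∣≡1 : ∣ S ∩ K ∣ ≡ 1
        ∣S∩K∣≡1 = trans (cong ∣_∣ (⊆-antisym S∩K⊆⁅w⁆ ⁅w⁆⊆S∩K)) (∣⁅x⁆∣≡1 w)
          where
          S∩K⊆⁅w⁆ : S ∩ K ⊆ ⁅ w ⁆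
          S∩K⊆⁅w⁆ x∈ = subst (_∈ ⁅ w ⁆) (sym (uncurry S∩K≡w (x∈p∩q⁻ S K x∈))) (x∈⁅x⁆ w)
          ⁅w⁆⊆S∩K : ⁅ w ⁆ ⊆ S ∩ K
          ⁅w⁆⊆S∩K {x} x∈ = subst (_∈ S ∩ K) (sym (x∈⁅y⁆⇒x≡y w x∈)) (x∈p∩q⁺ (w∈S , w∈K))

      module Covering (cover : ∀ x → x ∈ S ⊎ x ∈ K ⊎ x ≡ t₁ ⊎ x ≡ t₂) where

        t₁~S : ∀ {s} → s ∈ S → s ≢ w → t₁ ~ s
        t₁~S {s} s∈S s≢w with CriticalEdge.dominates E₁ s s≢w
        ... | inj₁ (inj₁ s≡t₁) = ⊥-elim (t₁∉S (subst (_∈ S) s≡t₁ s∈S))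
        ... | inj₁ (inj₂ s~t₁) = ~-sym s~t₁
        ... | inj₂ (inj₁ s≡s₁) = subst (t₁ ~_) (sym s≡s₁) (CriticalEdge.a~b E₁)
        ... | inj₂ (inj₂ s~s₁) = ⊥-elim (S-independent _ _ s∈S s₁∈S s~s₁)
          where
          s₁∈S : CriticalEdge.b E₁ ∈ S
          s₁∈S with cover (CriticalEdge.b E₁)
          ... | inj₁ s₁∈S                = s₁∈S
          ... | inj₂ (inj₁ s₁∈K)         = ⊥-elim (critical-edge-end∉K w∈K (CriticalEdge.flip E₁) s₁∈K)
          ... | inj₂ (inj₂ (inj₁ s₁≡t₁)) = ⊥-elim (~-irrefl t₁ (subst (t₁ ~_) s₁≡t₁ (CriticalEdge.a~b E₁)))
          ... | inj₂ (inj₂ (inj₂ s₁≡t₂)) = ⊥-elim (CriticalEdge.v≁b E₁ (subst (w ~_) (sym s₁≡t₂) w~t₂))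

        w-neighbour≡t₂ : ∀ {k} → k ∈ K → (E : CriticalEdge k) → w ~ CriticalEdge.a E → CriticalEdge.a E ≡ t₂
        w-neighbour≡t₂ k∈K E w~a with cover (CriticalEdge.a E)
        ... | inj₁ a∈S               = ⊥-elim (S-independent _ _ w∈S a∈S w~a)
        ... | inj₂ (inj₁ a∈K)        = ⊥-elim (critical-edge-end∉K k∈K E a∈K)
        ... | inj₂ (inj₂ (inj₁ a≡t₁)) = ⊥-elim (w≁t₁ (subst (w ~_) a≡t₁ w~a))
        ... | inj₂ (inj₂ (inj₂ a≡t₂)) = a≡t₂

        K≁t₂ : ∀ {k} → k ∈ K → k ≢ w → k ≁ t₂
        K≁t₂ k∈K k≢w with edge-at-w k∈K k≢w
        ... | E , w~a = subst (_ ≁_) (w-neighbour≡t₂ k∈K E w~a) (CriticalEdge.v≁a E)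

        t₂-undominated-by-K : ∀ {k} → k ∈ K → k ≢ w → ¬ Dominates G k t₂
        t₂-undominated-by-K k∈K _   (inj₁ t₂≡k) = t₂∉K (subst (_∈ K) (sym t₂≡k) k∈K)
        t₂-undominated-by-K k∈K k≢w (inj₂ t₂~k) = K≁t₂ k∈K k≢w (~-sym t₂~k)

        K-misses-S : ∀ {k} → k ∈ K → k ≢ w → t₁ ≁ t₂ → ∃[ s ] (s ∈ S × s ≢ w × k ≁ s)
        K-misses-S k∈K k≢w t₁≁t₂ with edge-at-w k∈K k≢w
        ... | E , w~a with w-neighbour≡t₂ k∈K E w~a | cover (CriticalEdge.b E)
        ...   | a≡t₂ | inj₁ b∈S = _ , b∈S , b≢w , CriticalEdge.v≁b E
          where
          b≢w : CriticalEdge.b E ≢ w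
          b≢w b≡w = critical-edge-end∉K k∈K (CriticalEdge.flip E) (subst (_∈ K) (sym b≡w) w∈K)
        ...   | _    | inj₂ (inj₁ b∈K) = ⊥-elim (critical-edge-end∉K k∈K (CriticalEdge.flip E) b∈K)
        ...   | a≡t₂ | inj₂ (inj₂ (inj₁ b≡t₁)) =
          ⊥-elim (t₁≁t₂ (subst₂ _~_ b≡t₁ a≡t₂ (~-sym (CriticalEdge.a~b E))))
        ...   | a≡t₂ | inj₂ (inj₂ (inj₂ b≡t₂)) =
          ⊥-elim (~-irrefl _ (subst (_ ~_) (trans b≡t₂ (sym a≡t₂)) (CriticalEdge.a~b E)))

        t₁-non-neighbour : t₁ ≁ x → x ≢ t₁ → x ≡ w ⊎ (x ∈ K × x ≢ w) ⊎ x ≡ t₂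
        t₁-non-neighbour {x} t₁≁x x≢t₁ with cover x
        ... | inj₂ (inj₂ (inj₁ x≡t₁)) = ⊥-elim (x≢t₁ x≡t₁)
        ... | inj₂ (inj₂ (inj₂ x≡t₂)) = inj₂ (inj₂ x≡t₂)
        ... | inj₁ x∈S with x ≟ w
        ...   | yes x≡w = inj₁ x≡w
        ...   | no x≢w  = ⊥-elim (t₁≁x (t₁~S x∈S x≢w))
        t₁-non-neighbour {x} t₁≁x x≢t₁ | inj₂ (inj₁ x∈K) with x ≟ w
        ...   | yes x≡w = inj₁ x≡w
        ...   | no x≢w  = inj₂ (inj₁ (x∈K , x≢w))

        w-end-impossible : ∀ {k} → k ∈ K → k ≢ w → t₁ ≁ t₂ → (∀ z → z ≢ t₁ → Dominates₂ G k w z) → ⊥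
        w-end-impossible k∈K k≢w t₁≁t₂ dominated with K-misses-S k∈K k≢w t₁≁t₂
        ... | s , s∈S , s≢w , k≁s with dominated s (λ s≡t₁ → t₁∉S (subst (_∈ S) s≡t₁ s∈S))
        ...   | inj₁ (inj₁ s≡k) = s≢w (S∩K≡w s∈S (subst (_∈ K) (sym s≡k) k∈K))
        ...   | inj₁ (inj₂ s~k) = k≁s (~-sym s~k)
        ...   | inj₂ (inj₁ s≡w) = s≢w s≡w
        ...   | inj₂ (inj₂ s~w) = S-independent _ _ s∈S w∈S s~w

        left-end-impossible : ∀ {k x} → k ∈ K → k ≢ w → t₁ ≁ t₂ → t₁ ≁ k →
          t₁ ~ x → (∀ z → z ≢ k → Dominates₂ G t₁ x z) → ⊥
        left-end-impossible {k} {x} k∈K k≢w t₁≁t₂ t₁≁k t₁~x dominated with dominated w (k≢w ∘ sym)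
        ... | inj₁ (inj₁ w≡t₁) = t₁∉K (subst (_∈ K) w≡t₁ w∈K)
        ... | inj₁ (inj₂ w~t₁) = w≁t₁ w~t₁
        ... | inj₂ (inj₁ w≡x)  = w≁t₁ (~-sym (subst (t₁ ~_) (sym w≡x) t₁~x))
        ... | inj₂ (inj₂ w~x) with cover x
        ...   | inj₁ x∈S                = S-independent w x w∈S x∈S w~x
        ...   | inj₂ (inj₂ (inj₁ x≡t₁)) = ~-irrefl t₁ (subst (t₁ ~_) x≡t₁ t₁~x)
        ...   | inj₂ (inj₂ (inj₂ x≡t₂)) = t₁≁t₂ (subst (t₁ ~_) x≡t₂ t₁~x)
        ...   | inj₂ (inj₁ x∈K) with x ≟ k
        ...     | yes x≡k = t₁≁k (subst (t₁ ~_) x≡k t₁~x)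
        ...     | no x≢k  = no-dominating-pair (inj₂ t₁~x)
                              (dominates-all (inj₂ (inj₂ (K-clique k x k∈K x∈K (x≢k ∘ sym)))) dominated)

        right-end-impossible : ∀ {k x} → k ∈ K → k ≢ w → t₁ ≁ t₂ → t₁ ≁ k →
          k ~ x → (∀ z → z ≢ t₁ → Dominates₂ G k x z) → ⊥
        right-end-impossible {k} {x} k∈K k≢w t₁≁t₂ t₁≁k k~x dominated with dominated t₂ (t₁≢t₂ ∘ sym)
        ... | inj₁ t₂-by-k     = t₂-undominated-by-K k∈K k≢w t₂-by-k
        ... | inj₂ (inj₁ t₂≡x) = K≁t₂ k∈K k≢w (subst (k ~_) (sym t₂≡x) k~x)
        ... | inj₂ (inj₂ t₂~x) with cover x
        ...   | inj₂ (inj₂ (inj₁ x≡t₁)) = t₁≁k (~-sym (subst (k ~_) x≡t₁ k~x))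
        ...   | inj₂ (inj₂ (inj₂ x≡t₂)) = K≁t₂ k∈K k≢w (subst (k ~_) x≡t₂ k~x)
        ...   | inj₁ x∈S with x ≟ w
        ...     | yes refl = w-end-impossible k∈K k≢w t₁≁t₂ dominated
        ...     | no x≢w   =
          no-dominating-pair (inj₂ k~x) (dominates-all (inj₂ (inj₂ (t₁~S x∈S x≢w))) dominated)
        right-end-impossible {k} {x} k∈K k≢w t₁≁t₂ t₁≁k k~x dominated | inj₂ (inj₂ t₂~x) | inj₂ (inj₁ x∈K)
          with x ≟ w
        ...     | yes refl = w-end-impossible k∈K k≢w t₁≁t₂ dominated
        ...     | no x≢w   = K≁t₂ x∈K x≢w (~-sym t₂~x)

        t₁≁t₂⇒t₁~K : t₁ ≁ t₂ → ∀ {k} → k ∈ K → k ≢ w → t₁ ~ k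
        t₁≁t₂⇒t₁~K t₁≁t₂ {k} k∈K k≢w with t₁ ~? k
        ... | yes t₁~k = t₁~k
        ... | no t₁≁k with edge-critical (λ t₁≡k → t₁∉K (subst (_∈ K) (sym t₁≡k) k∈K)) t₁≁k
        ...   | both-ends dominated =
          ⊥-elim ([ [ t₁≢t₂ ∘ sym , t₁≁t₂ ∘ ~-sym ]′ , t₂-undominated-by-K k∈K k≢w ]′ (dominated t₂))
        ...   | left-end t₁~x dominated  = ⊥-elim (left-end-impossible k∈K k≢w t₁≁t₂ t₁≁k t₁~x dominated)
        ...   | right-end k~x dominated = ⊥-elim (right-end-impossible k∈K k≢w t₁≁t₂ t₁≁k k~x dominated)

        w-k-edge⇒t₂≁S : ∀ {k} → k ∈ K → k ≢ w → (∀ z → z ≢ t₁ → Dominates₂ G w k z) →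
          ∀ {s} → s ∈ S → s ≢ w → t₂ ≁ s
        w-k-edge⇒t₂≁S {k} k∈K k≢w dominated {s} s∈S s≢w t₂~s =
          no-dominating-pair (inj₂ (~-sym (S~k s∈S s≢w))) dominated-by-k-s
          where
          S~k : ∀ {s} → s ∈ S → s ≢ w → s ~ k
          S~k {s} s∈S s≢w with dominated s (λ s≡t₁ → t₁∉S (subst (_∈ S) s≡t₁ s∈S))
          ... | inj₁ (inj₁ s≡w) = ⊥-elim (s≢w s≡w)
          ... | inj₁ (inj₂ s~w) = ⊥-elim (S-independent _ _ s∈S w∈S s~w)
          ... | inj₂ (inj₁ s≡k) = ⊥-elim (s≢w (S∩K≡w s∈S (subst (_∈ K) (sym s≡k) k∈K)))
          ... | inj₂ (inj₂ s~k) = s~k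
          dominated-by-k-s : ∀ z → Dominates₂ G k s z
          dominated-by-k-s z with cover z
          ... | inj₂ (inj₂ (inj₁ refl)) = inj₂ (inj₂ (t₁~S s∈S s≢w))
          ... | inj₂ (inj₂ (inj₂ refl)) = inj₂ (inj₂ t₂~s)
          ... | inj₁ z∈S with z ≟ w
          ...   | yes refl = inj₁ (inj₂ (K-clique w k w∈K k∈K (k≢w ∘ sym)))
          ...   | no z≢w   = inj₁ (inj₂ (S~k z∈S z≢w))
          dominated-by-k-s z | inj₂ (inj₁ z∈K) with z ≟ k
          ...   | yes z≡k = inj₁ (inj₁ z≡k)
          ...   | no z≢k  = inj₁ (inj₂ (K-clique z k z∈K k∈K z≢k))

        S-exchange : (∀ {s} → s ∈ S → s ≢ w → t₂ ≁ s) → G1Decomposition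
        S-exchange t₂≁S = record
          { S = S′ ; K = K ; apex = t₁ ; S-independent = S′-independent ; K-clique = K-clique
          ; partition = partition ; S∩K-empty = S′∩K-empty ; apex∉S = t₁∉S′ ; apex∉K = t₁∉K ; 2≤∣K∣ = 2≤∣K∣ }
          where
          S′ : Subset n
          S′ = exchange S w t₂
          S′-independent : IsIndependent G S′
          S′-independent x y x∈ y∈ with to (∈exchange⇔ {p = S}) x∈ | to (∈exchange⇔ {p = S}) y∈
          ... | inj₁ (x∈S , _)   | inj₁ (y∈S , _)   = S-independent x y x∈S y∈S
          ... | inj₁ (x∈S , x≢w) | inj₂ refl        = t₂≁S x∈S x≢w ∘ ~-sym
          ... | inj₂ refl        | inj₁ (y∈S , y≢w) = t₂≁S y∈S y≢w
          ... | inj₂ refl        | inj₂ refl        = ~-irrefl t₂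
          partition : ∀ x → x ∈ S′ ⊎ x ∈ K ⊎ x ≡ t₁
          partition x with cover x
          ... | inj₂ (inj₁ x∈K)         = inj₂ (inj₁ x∈K)
          ... | inj₂ (inj₂ (inj₁ x≡t₁)) = inj₂ (inj₂ x≡t₁)
          ... | inj₂ (inj₂ (inj₂ x≡t₂)) = inj₁ (from (∈exchange⇔ {p = S}) (inj₂ x≡t₂))
          ... | inj₁ x∈S with x ≟ w
          ...   | yes x≡w = inj₂ (inj₁ (subst (_∈ K) (sym x≡w) w∈K))
          ...   | no x≢w  = inj₁ (from (∈exchange⇔ {p = S}) (inj₁ (x∈S , x≢w)))
          S′∩K-empty : ∀ {x} → x ∈ S′ → x ∉ K
          S′∩K-empty x∈ x∈K with to (∈exchange⇔ {p = S}) x∈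
          ... | inj₁ (x∈S , x≢w) = x≢w (S∩K≡w x∈S x∈K)
          ... | inj₂ x≡t₂        = t₂∉K (subst (_∈ K) x≡t₂ x∈K)
          t₁∉S′ : t₁ ∉ S′
          t₁∉S′ = [ t₁∉S ∘ proj₁ , t₁≢t₂ ]′ ∘ to (∈exchange⇔ {p = S})

        K-exchange : (∀ {k} → k ∈ K → k ≢ w → t₁ ~ k) → G1Decomposition
        K-exchange t₁~K = record
          { S = S ; K = K′ ; apex = t₂ ; S-independent = S-independent ; K-clique = K′-clique
          ; partition = partition ; S∩K-empty = S∩K′-empty ; apex∉S = t₂∉S ; apex∉K = t₂∉K′
          ; 2≤∣K∣ = 2≤∣p∣ (from (∈exchange⇔ {p = K}) (inj₂ refl))
                         (from (∈exchange⇔ {p = K}) (inj₁ (k₀∈K , k₀≢w)))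
                         (λ t₁≡k₀ → t₁∉K (subst (_∈ K) (sym t₁≡k₀) k₀∈K)) }
          where
          K′ : Subset n
          K′ = exchange K w t₁
          K′-clique : IsClique G K′
          K′-clique x y x∈ y∈ x≢y with to (∈exchange⇔ {p = K}) x∈ | to (∈exchange⇔ {p = K}) y∈
          ... | inj₁ (x∈K , _)   | inj₁ (y∈K , _)   = K-clique x y x∈K y∈K x≢y
          ... | inj₁ (x∈K , x≢w) | inj₂ refl        = ~-sym (t₁~K x∈K x≢w)
          ... | inj₂ refl        | inj₁ (y∈K , y≢w) = t₁~K y∈K y≢w
          ... | inj₂ refl        | inj₂ refl        = ⊥-elim (x≢y refl)
          partition : ∀ x → x ∈ S ⊎ x ∈ K′ ⊎ x ≡ t₂
          partition x with cover x
          ... | inj₁ x∈S                = inj₁ x∈S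
          ... | inj₂ (inj₂ (inj₁ x≡t₁)) = inj₂ (inj₁ (from (∈exchange⇔ {p = K}) (inj₂ x≡t₁)))
          ... | inj₂ (inj₂ (inj₂ x≡t₂)) = inj₂ (inj₂ x≡t₂)
          ... | inj₂ (inj₁ x∈K) with x ≟ w
          ...   | yes x≡w = inj₁ (subst (_∈ S) (sym x≡w) w∈S)
          ...   | no x≢w  = inj₂ (inj₁ (from (∈exchange⇔ {p = K}) (inj₁ (x∈K , x≢w))))
          S∩K′-empty : ∀ {x} → x ∈ S → x ∉ K′
          S∩K′-empty x∈S x∈ with to (∈exchange⇔ {p = K}) x∈
          ... | inj₁ (x∈K , x≢w) = x≢w (S∩K≡w x∈S x∈K)
          ... | inj₂ x≡t₁        = t₁∉S (subst (_∈ S) x≡t₁ x∈S)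
          t₂∉K′ : t₂ ∉ K′
          t₂∉K′ = [ t₂∉K ∘ proj₁ , t₁≢t₂ ∘ sym ]′ ∘ to (∈exchange⇔ {p = K})

        from-w-edge : (E : CriticalEdge t₁) → CriticalEdge.a E ≡ w → G1Decomposition
        from-w-edge E a≡w with t₁-non-neighbour (CriticalEdge.v≁b E) (CriticalEdge.b≢v E)
        ... | inj₁ b≡w                =
          ⊥-elim (~-irrefl _ (subst (_ ~_) (trans b≡w (sym a≡w)) (CriticalEdge.a~b E)))
        ... | inj₂ (inj₁ (b∈K , b≢w)) = S-exchange (w-k-edge⇒t₂≁S b∈K b≢w
          (subst (λ a → ∀ z → z ≢ t₁ → Dominates₂ G a (CriticalEdge.b E) z) a≡w (CriticalEdge.dominates E)))
        ... | inj₂ (inj₂ b≡t₂)        = K-exchange (t₁≁t₂⇒t₁~K (subst (t₁ ≁_) b≡t₂ (CriticalEdge.v≁b E)))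

        decomposition : G1Decomposition
        decomposition with critical-edge t₁
        ... | E with t₁-non-neighbour (CriticalEdge.v≁a E) (CriticalEdge.a≢v E)
                   | t₁-non-neighbour (CriticalEdge.v≁b E) (CriticalEdge.b≢v E)
        ...   | inj₁ a≡w                | _                       = from-w-edge E a≡w
        ...   | _                       | inj₁ b≡w                = from-w-edge (CriticalEdge.flip E) b≡w
        ...   | inj₂ (inj₁ (a∈K , a≢w)) | inj₂ (inj₁ (b∈K , b≢w)) = ⊥-elim
          ([ t₂-undominated-by-K a∈K a≢w , t₂-undominated-by-K b∈K b≢w ]′
             (CriticalEdge.dominates E t₂ (t₁≢t₂ ∘ sym)))
        ...   | inj₂ (inj₁ (a∈K , a≢w)) | inj₂ (inj₂ b≡t₂)        =
          ⊥-elim (K≁t₂ a∈K a≢w (subst (_ ~_) b≡t₂ (CriticalEdge.a~b E)))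
        ...   | inj₂ (inj₂ a≡t₂)        | inj₂ (inj₁ (b∈K , b≢w)) =
          ⊥-elim (K≁t₂ b∈K b≢w (subst (_ ~_) a≡t₂ (~-sym (CriticalEdge.a~b E))))
        ...   | inj₂ (inj₂ a≡t₂)        | inj₂ (inj₂ b≡t₂)        =
          ⊥-elim (~-irrefl _ (subst (_ ~_) (trans b≡t₂ (sym a≡t₂)) (CriticalEdge.a~b E)))

      ∈X⁻ : x ∈ X → x ∈ S ⊎ x ∈ K ⊎ x ≡ t₁ ⊎ x ≡ t₂
      ∈X⁻ x∈X with x∈p∪⁅y⁆⁻ ((S ∪ K) ∪ ⁅ t₁ ⁆) x∈X
      ... | inj₂ x≡t₂ = inj₂ (inj₂ (inj₂ x≡t₂))
      ... | inj₁ x∈ with x∈p∪⁅y⁆⁻ (S ∪ K) x∈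
      ...   | inj₂ x≡t₁  = inj₂ (inj₂ (inj₁ x≡t₁))
      ...   | inj₁ x∈S∪K = map₂ inj₁ (x∈p∪q⁻ S K x∈S∪K)

      extremal : ExtremalSet α ω
      extremal = record
        { X = X ; ∣X∣≡α+ω+1 = ∣X∣≡α+ω+1
        ; covering⇒decomposition = λ covered → Covering.decomposition (∈X⁻ ∘ covered) }

    extremal-set : ExtremalSet α ω
    extremal-set with nonempty? (S ∩ K)
    ... | yes (w , w∈S∩K) = Intersecting.extremal (proj₁ (x∈p∩q⁻ S K w∈S∩K)) (proj₂ (x∈p∩q⁻ S K w∈S∩K))
    ... | no S∩K-empty    = Disjoint.extremal λ x∈S x∈K → S∩K-empty (_ , x∈p∩q⁺ (x∈S , x∈K))

theorem3p6 : (n : ℕ) (G : Graph n) (α ω : ℕ) →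
    IsSimple G → MaximalVertexCritical G 3 →
    IndependenceNumberIs G α → CliqueNumberIs G ω →
    (α + ω + 1 ≤ n) ×
    ((α + ω + 1 ≡ n) ⇔ (∃[ l ] (2 ≤ l × Isomorphic G (G1 l))))
theorem3p6 n G α ω simple critical independence clique = bound , mk⇔ tight⇒G1 G1⇒tight
  where
  open MaximalCritical G simple critical
  open ExtremalSet (Extremal.extremal-set independence clique)
  bound : α + ω + 1 ≤ n
  bound = subst (_≤ n) ∣X∣≡α+ω+1 (∣p∣≤n X)
  tight⇒G1 : α + ω + 1 ≡ n → ∃[ l ] (2 ≤ l × Isomorphic G (G1 l))
  tight⇒G1 tight = decomposition⇒G1 (covering⇒decomposition λ x →
    subst (x ∈_) (sym (∣p∣≡n⇒p≡⊤ (trans ∣X∣≡α+ω+1 tight))) ∈⊤)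
  G1⇒tight : ∃[ l ] (2 ≤ l × Isomorphic G (G1 l)) → α + ω + 1 ≡ n
  G1⇒tight (_ , _ , isomorphism) = ≤-antisym bound (G1-order≤ independence clique isomorphism)
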